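{- Let $B$ be a bouquet with $n$ edges which contains exactly one non-orientable loop. Then the intersection matrix $A(B)$ is a principal unimodular matrix, i.e. every nonsingular principal submatrix of $A(B)$ has determinant $1$ or $-1$.
   Context: A bouquet is a ribbon graph (surface with boundary made of vertex discs and edge ribbons) with exactly one vertex; all edges are loops, and a loop is non-orientable if together with the vertex it forms a Möbius band. Intersection matrix $A(B)$: on the boundary circle of the vertex, each edge $i$ gives a chord joining its two ends, with framing $1$ if the loop is non-orientable, $0$ otherwise. Choose an ordering $(a_i,b_i)$ of the endpoints of each chord. $A_{i,i}$ is the framing of chord $i$; for $i<j$, $A_{i,j}=1$ if the cyclic order is $a_i,a_j,b_i,b_j$, $-1$ if it is $a_i,b_j,b_i,a_j$, and $0$ otherwise; for $j<i$, $A_{i,j}=-A_{j,i}$. -}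

module Defs where

open import Data.Nat using (ℕ; zero; suc; _*_)
open import Data.Bool using (Bool; true; false; if_then_else_)
open import Data.Fin using (Fin; zero; suc; toℕ; punchIn; _<_; _<?_)
open import Data.Integer using (ℤ; +_; -_; _+_) renaming (_*_ to _*ℤ_)
open import Data.Product using (_×_; _,_; Σ; ∃)
open import Data.Sum using (_⊎_)
open import Relation.Nullary using (¬_; Dec; does)
open import Relation.Nullary.Decidable using (_×-dec_; _⊎-dec_)
open import Relation.Binary.PropositionalEquality using (_≡_; _≢_)
open import Function.Definitions using (Injective)

-- A bouquet with n edges (one vertex, n loops) is encoded by its signed
-- rotation system: the boundary circle of the vertex carries 2n points
-- 0,1,…,2n-1 in cyclic order; edge i occupies the two points
-- (a i) and (b i) (this also fixes the chosen ordering (a_i,b_i) of the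
-- ends of chord i), and  nonOrientable i  is the framing of chord i
-- (true iff loop i together with the vertex is a Möbius band).

record Bouquet (n : ℕ) : Set where
  field
    a            : Fin n → Fin (2 * n)
    b            : Fin n → Fin (2 * n)
    a-injective  : Injective _≡_ _≡_ a
    b-injective  : Injective _≡_ _≡_ b
    a≢b          : ∀ i j → a i ≢ b j
    nonOrientable : Fin n → Bool

open Bouquet public

ExactlyOneNonOrientable : ∀ {n} → Bouquet n → Set
ExactlyOneNonOrientable {n} B =
  Σ (Fin n) λ i → (nonOrientable B i ≡ true) ×
                  (∀ j → nonOrientable B j ≡ true → j ≡ i)

Cyc3 : ∀ {m} → Fin m → Fin m → Fin m → Set
Cyc3 x y z = ((x < y) × (y < z)) ⊎ (((y < z) × (z < x)) ⊎ ((z < x) × (x < y)))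

cyc3? : ∀ {m} (x y z : Fin m) → Dec (Cyc3 x y z)
cyc3? x y z = ((x <? y) ×-dec (y <? z)) ⊎-dec
              (((y <? z) ×-dec (z <? x)) ⊎-dec ((z <? x) ×-dec (x <? y)))

Cyc4 : ∀ {m} → Fin m → Fin m → Fin m → Fin m → Set
Cyc4 p q r s = Cyc3 p q r × Cyc3 p r s

cyc4? : ∀ {m} (p q r s : Fin m) → Dec (Cyc4 p q r s)
cyc4? p q r s = cyc3? p q r ×-dec cyc3? p r s

bool→ℤ : Bool → ℤ
bool→ℤ true  = + 1
bool→ℤ false = + 0

upperEntry : ∀ {n} → Bouquet n → Fin n → Fin n → ℤ
upperEntry B i j =
  if does (cyc4? (a B i) (a B j) (b B i) (b B j)) then + 1
  else if does (cyc4? (a B i) (b B j) (b B i) (a B j)) then - (+ 1)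
  else + 0

intersectionMatrix : ∀ {n} → Bouquet n → Fin n → Fin n → ℤ
intersectionMatrix B i j with does (i <? j) | does (j <? i)
... | true  | _     = upperEntry B i j
... | false | true  = - upperEntry B j i
... | false | false = bool→ℤ (nonOrientable B i)

sumFin : ∀ {n} → (Fin n → ℤ) → ℤ
sumFin {zero}  f = + 0
sumFin {suc n} f = f zero + sumFin (λ i → f (suc i))

signFin : ∀ {n} → Fin n → ℤ
signFin zero          = + 1
signFin (suc zero)    = - (+ 1)
signFin (suc (suc i)) = signFin i

det : ∀ {n} → (Fin n → Fin n → ℤ) → ℤ
det {zero}  M = + 1
det {suc n} M =
  sumFin (λ j → signFin j *ℤ (M zero j *ℤ det (λ r c → M (suc r) (punchIn j c))))

-- Principal submatrices: rows and columns indexed by the image of a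
-- strictly increasing map σ : Fin k → Fin n (i.e. a k-subset of indices).

StrictlyIncreasing : ∀ {k n} → (Fin k → Fin n) → Set
StrictlyIncreasing σ = ∀ i j → i < j → σ i < σ j

principalSubmatrix : ∀ {k n} → (Fin n → Fin n → ℤ) → (Fin k → Fin n) →
                     Fin k → Fin k → ℤ
principalSubmatrix M σ i j = M (σ i) (σ j)

PrincipallyUnimodular : ∀ {n} → (Fin n → Fin n → ℤ) → Set
PrincipallyUnimodular {n} M =
  ∀ (k : ℕ) (σ : Fin k → Fin n) → StrictlyIncreasing σ →
    ¬ (det (principalSubmatrix M σ) ≡ + 0) →
    (det (principalSubmatrix M σ) ≡ + 1) ⊎ (det (principalSubmatrix M σ) ≡ - (+ 1))

-- Off the diagonal, A(B) is the interlace matrix of the chord diagram of B, drawn on the line 0 < 1 < … < 2n-1: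
-- the entry for chords i, j is χ(aᵢ,aⱼ) - χ(aᵢ,bⱼ) - χ(bᵢ,aⱼ) + χ(bᵢ,bⱼ) with χ(x,y) = [x < y], which is ±1 when
-- exactly one end of chord j lies between the ends of chord i and 0 otherwise.
--
-- The interlace matrix M of any chord diagram has determinant 0 or ±1, and 0 when the number of chords is odd.
-- If row 0 of M vanishes, det M = 0.  Otherwise chord 0 crosses some chord q, M₀q = ±1, and the Schur complement
-- of the block [[0, M₀q], [-M₀q, 0]] on the chords 0 and q is again an interlace matrix: that of the diagram in
-- which the two segments of the line running from the first to the second and from the third to the fourth of
-- the four ends of these chords are exchanged.  As the block has determinant 1, this pivot preserves the
-- determinant and removes two chords.
--
-- A principal submatrix containing the non-orientable loop is an interlace matrix M plus a single 1 on the
-- diagonal, so its determinant is det M + det M′ with M′ the interlace matrix of one chord fewer; one of the two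
-- sizes is odd, so one of the two determinants vanishes.

module Submission where

open import Defs
open import Data.Nat as ℕ using (ℕ; zero; suc)
import Data.Nat.Properties as ℕ
open import Data.Fin as Fin using (Fin; zero; suc; toℕ; punchIn; punchOut; _≟_)
import Data.Fin.Properties as Fin
open import Data.Fin.Permutation.Components using (transpose)
open import Data.Bool as Bool using (Bool; true; false; not; _∧_; _∨_; if_then_else_)
open import Data.Integer as ℤ using (ℤ; -_; _+_; _*_; _-_; 0ℤ; 1ℤ; -1ℤ; _^_)
import Data.Integer.Properties as ℤ
open import Data.Integer.Solver using (module +-*-Solver)
open +-*-Solver
open import Data.Empty using (⊥-elim)
open import Data.Product using (_×_; _,_; ∃; proj₁; proj₂)
open import Data.Sum using (_⊎_; inj₁; inj₂)
open import Function using (_∘_)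
open import Relation.Nullary using (Dec; yes; no; does; ¬?; contradiction)
open import Relation.Nullary.Decidable using (dec-true; dec-false; decidable-stable; toWitness)
open import Relation.Binary.PropositionalEquality
open import Relation.Binary.Definitions using (tri<; tri≈; tri>)

2ℤ : ℤ
2ℤ = ℤ.+ 2

Matrix : ℕ → Set
Matrix n = Fin n → Fin n → ℤ

-- Finite sums

sumFin-cong : ∀ {n} {f g : Fin n → ℤ} → (∀ i → f i ≡ g i) → sumFin f ≡ sumFin g
sumFin-cong {zero}  f≗g = refl
sumFin-cong {suc n} f≗g = cong₂ _+_ (f≗g zero) (sumFin-cong (f≗g ∘ suc))

sumFin-zero : ∀ {n} {f : Fin n → ℤ} → (∀ i → f i ≡ 0ℤ) → sumFin f ≡ 0ℤ
sumFin-zero {zero}  f≗0 = refl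
sumFin-zero {suc n} f≗0 = cong₂ _+_ (f≗0 zero) (sumFin-zero (f≗0 ∘ suc))

sumFin-+ : ∀ {n} (f g : Fin n → ℤ) → sumFin (λ i → f i + g i) ≡ sumFin f + sumFin g
sumFin-+ {zero}  f g = refl
sumFin-+ {suc n} f g = begin
  (f zero + g zero) + sumFin (λ i → f (suc i) + g (suc i))
    ≡⟨ cong ((f zero + g zero) +_) (sumFin-+ (f ∘ suc) (g ∘ suc)) ⟩
  (f zero + g zero) + (sumFin (f ∘ suc) + sumFin (g ∘ suc))
    ≡⟨ solve 4 (λ a b c d → (a :+ b) :+ (c :+ d) := (a :+ c) :+ (b :+ d)) refl
               (f zero) (g zero) (sumFin (f ∘ suc)) (sumFin (g ∘ suc)) ⟩
  (f zero + sumFin (f ∘ suc)) + (g zero + sumFin (g ∘ suc)) ∎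
  where open ≡-Reasoning

sumFin-*ˡ : ∀ {n} (c : ℤ) (f : Fin n → ℤ) → sumFin (λ i → c * f i) ≡ c * sumFin f
sumFin-*ˡ {zero}  c f = sym (ℤ.*-zeroʳ c)
sumFin-*ˡ {suc n} c f = trans (cong (c * f zero +_) (sumFin-*ˡ c (f ∘ suc)))
                              (sym (ℤ.*-distribˡ-+ c (f zero) _))

sumFin-punchIn : ∀ {n} (f : Fin (suc n) → ℤ) (c : Fin (suc n)) →
                 sumFin f ≡ f c + sumFin (f ∘ punchIn c)
sumFin-punchIn f zero = refl
sumFin-punchIn {suc n} f (suc c) =
  trans (cong (f zero +_) (sumFin-punchIn (f ∘ suc) c))
        (solve 3 (λ a b s → a :+ (b :+ s) := b :+ (a :+ s)) refl (f zero) (f (suc c)) _)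

sumFin-single : ∀ {n} (f : Fin (suc n) → ℤ) (c : Fin (suc n)) →
                (∀ j → j ≢ c → f j ≡ 0ℤ) → sumFin f ≡ f c
sumFin-single f c f≗0 = begin
  sumFin f                          ≡⟨ sumFin-punchIn f c ⟩
  f c + sumFin (f ∘ punchIn c)      ≡⟨ cong (f c +_) (sumFin-zero (λ i → f≗0 _ (Fin.punchInᵢ≢i c i))) ⟩
  f c + 0ℤ                          ≡⟨ ℤ.+-identityʳ (f c) ⟩
  f c                               ∎
  where open ≡-Reasoning

sumFin-transpose : ∀ {n} (f g : Fin (suc n) → ℤ) {c d : Fin (suc n)} (c≢d : c ≢ d) →
  (∀ j → j ≢ c → j ≢ d → g j ≡ f j) → g c ≡ f d → g d ≡ f c → sumFin g ≡ sumFin f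
sumFin-transpose {zero} f g {zero} {zero} c≢d _ _ _ = ⊥-elim (c≢d refl)
sumFin-transpose {suc n} f g {c} {d} c≢d g≗f gc gd = begin
  sumFin g                                  ≡⟨ pick g ⟩
  g c + (g d + sumFin (g ∘ rest))           ≡⟨ cong₂ (λ u v → u + (v + sumFin (g ∘ rest))) gc gd ⟩
  f d + (f c + sumFin (g ∘ rest))           ≡⟨ cong (λ s → f d + (f c + s)) (sumFin-cong rest-eq) ⟩
  f d + (f c + sumFin (f ∘ rest))           ≡⟨ solve 3 (λ a b s → a :+ (b :+ s) := b :+ (a :+ s)) refl
                                                       (f d) (f c) (sumFin (f ∘ rest)) ⟩
  f c + (f d + sumFin (f ∘ rest))           ≡⟨ sym (pick f) ⟩
  sumFin f                                  ∎
  where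
  open ≡-Reasoning
  d′ = punchOut c≢d
  rest : Fin n → Fin (suc (suc n))
  rest = punchIn c ∘ punchIn d′
  punchIn-c-d′ : punchIn c d′ ≡ d
  punchIn-c-d′ = Fin.punchIn-punchOut c≢d
  pick : ∀ h → sumFin h ≡ h c + (h d + sumFin (h ∘ rest))
  pick h = trans (sumFin-punchIn h c)
    (cong (h c +_) (trans (sumFin-punchIn (h ∘ punchIn c) d′) (cong (λ j → h j + sumFin (h ∘ rest)) punchIn-c-d′)))
  rest-eq : ∀ i → g (rest i) ≡ f (rest i)
  rest-eq i = g≗f _ (Fin.punchInᵢ≢i c _)
    (λ e → Fin.punchInᵢ≢i d′ i (Fin.punchIn-injective c _ _ (trans e (sym punchIn-c-d′))))

-- Determinants

minor : ∀ {n} → Matrix (suc n) → Fin (suc n) → Fin (suc n) → Matrix n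
minor M i j r c = M (punchIn i r) (punchIn j c)

laplaceTerm : ∀ {n} → Matrix (suc n) → Fin (suc n) → ℤ
laplaceTerm M j = signFin j * (M zero j * det (minor M zero j))

det-cong : ∀ {n} {M N : Matrix n} → (∀ i j → M i j ≡ N i j) → det M ≡ det N
det-cong {zero}  M≗N = refl
det-cong {suc n} M≗N = sumFin-cong λ j →
  cong₂ (λ x y → signFin j * (x * y)) (M≗N zero j) (det-cong (λ r c → M≗N (suc r) (punchIn j c)))

punchIn-≢ : ∀ {n} {j c : Fin (suc n)} (j≢c : j ≢ c) {x : Fin n} → x ≢ punchOut j≢c → punchIn j x ≢ c
punchIn-≢ {j = j} j≢c {x} x≢ e = x≢ (Fin.punchIn-injective j x _ (trans e (sym (Fin.punchIn-punchOut j≢c))))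

det-linear-by-terms : ∀ {n} (t : ℤ) (K M N : Matrix (suc n)) →
  (∀ j → laplaceTerm K j ≡ laplaceTerm M j + t * laplaceTerm N j) → det K ≡ det M + t * det N
det-linear-by-terms t K M N terms = begin
  sumFin (laplaceTerm K)                                ≡⟨ sumFin-cong terms ⟩
  sumFin (λ j → laplaceTerm M j + t * laplaceTerm N j)  ≡⟨ sumFin-+ (laplaceTerm M) (λ j → t * laplaceTerm N j) ⟩
  det M + sumFin (λ j → t * laplaceTerm N j)            ≡⟨ cong (det M +_) (sumFin-*ˡ t (laplaceTerm N)) ⟩
  det M + t * det N                                     ∎
  where open ≡-Reasoning

term-linear-entry : ∀ s k m n t dK dM dN → k ≡ m + t * n → dK ≡ dM → dK ≡ dN →
                    s * (k * dK) ≡ s * (m * dM) + t * (s * (n * dN))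
term-linear-entry s k m n t d d d refl refl refl =
  solve 5 (λ s m n t d → s :* ((m :+ t :* n) :* d) := s :* (m :* d) :+ t :* (s :* (n :* d))) refl s m n t d

term-linear-minor : ∀ s k m n t dK dM dN → k ≡ m → k ≡ n → dK ≡ dM + t * dN →
                    s * (k * dK) ≡ s * (m * dM) + t * (s * (n * dN))
term-linear-minor s k k k t dK dM dN refl refl refl =
  solve 5 (λ s k dM dN t → s :* (k :* (dM :+ t :* dN)) := s :* (k :* dM) :+ t :* (s :* (k :* dN))) refl s k dM dN t

module _ {n} (t : ℤ) (K M N : Matrix (suc n)) (j : Fin (suc n)) where

  term-linear-in-entry : K zero j ≡ M zero j + t * N zero j →
    (∀ r x → minor K zero j r x ≡ minor M zero j r x) → (∀ r x → minor K zero j r x ≡ minor N zero j r x) →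
    laplaceTerm K j ≡ laplaceTerm M j + t * laplaceTerm N j
  term-linear-in-entry Kj K≗M K≗N = term-linear-entry (signFin j) (K zero j) (M zero j) (N zero j) t
    (det (minor K zero j)) (det (minor M zero j)) (det (minor N zero j)) Kj (det-cong K≗M) (det-cong K≗N)

  term-linear-in-minor : K zero j ≡ M zero j → K zero j ≡ N zero j →
    det (minor K zero j) ≡ det (minor M zero j) + t * det (minor N zero j) →
    laplaceTerm K j ≡ laplaceTerm M j + t * laplaceTerm N j
  term-linear-in-minor = term-linear-minor (signFin j) (K zero j) (M zero j) (N zero j) t
    (det (minor K zero j)) (det (minor M zero j)) (det (minor N zero j))

det-linear-column : ∀ {n} (c : Fin n) (t : ℤ) (K M N : Matrix n) →
  (∀ r j → j ≢ c → K r j ≡ M r j) → (∀ r j → j ≢ c → K r j ≡ N r j) →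
  (∀ r → K r c ≡ M r c + t * N r c) → det K ≡ det M + t * det N
det-linear-column {suc n} c t K M N K≗M K≗N Kc = det-linear-by-terms t K M N term
  where
  term : ∀ j → laplaceTerm K j ≡ laplaceTerm M j + t * laplaceTerm N j
  term j with j ≟ c
  ... | yes refl = term-linear-in-entry t K M N j (Kc zero)
                     (λ r x → K≗M (suc r) (punchIn j x) (Fin.punchInᵢ≢i j x))
                     (λ r x → K≗N (suc r) (punchIn j x) (Fin.punchInᵢ≢i j x))
  ... | no j≢c = term-linear-in-minor t K M N j (K≗M zero j j≢c) (K≗N zero j j≢c)
                   (det-linear-column (punchOut j≢c) t (minor K zero j) (minor M zero j) (minor N zero j)
                      (λ r x x≢ → K≗M (suc r) (punchIn j x) (punchIn-≢ j≢c x≢))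
                      (λ r x x≢ → K≗N (suc r) (punchIn j x) (punchIn-≢ j≢c x≢))
                      (λ r → subst (λ z → K (suc r) z ≡ M (suc r) z + t * N (suc r) z)
                                   (sym (Fin.punchIn-punchOut j≢c)) (Kc (suc r))))

det-linear-row : ∀ {n} (i : Fin n) (t : ℤ) (K M N : Matrix n) →
  (∀ r j → r ≢ i → K r j ≡ M r j) → (∀ r j → r ≢ i → K r j ≡ N r j) →
  (∀ j → K i j ≡ M i j + t * N i j) → det K ≡ det M + t * det N
det-linear-row {suc n} zero t K M N K≗M K≗N Ki = det-linear-by-terms t K M N λ j →
  term-linear-in-entry t K M N j (Ki j) (λ r x → K≗M (suc r) (punchIn j x) λ ())
                                        (λ r x → K≗N (suc r) (punchIn j x) λ ())
det-linear-row {suc n} (suc i) t K M N K≗M K≗N Ki = det-linear-by-terms t K M N λ j →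
  term-linear-in-minor t K M N j (K≗M zero j λ ()) (K≗N zero j λ ())
    (det-linear-row i t (minor K zero j) (minor M zero j) (minor N zero j)
       (λ r x r≢ → K≗M (suc r) (punchIn j x) (r≢ ∘ Fin.suc-injective))
       (λ r x r≢ → K≗N (suc r) (punchIn j x) (r≢ ∘ Fin.suc-injective))
       (λ x → Ki (punchIn j x)))

data Adjacent : ∀ {n} → Fin n → Fin n → Set where
  zero-one : ∀ {n} → Adjacent {suc (suc n)} zero (suc zero)
  suc-suc  : ∀ {n} {c d : Fin n} → Adjacent c d → Adjacent (suc c) (suc d)

adjacent-toℕ : ∀ {n} {c d : Fin n} → Adjacent c d → toℕ d ≡ suc (toℕ c)
adjacent-toℕ zero-one    = refl
adjacent-toℕ (suc-suc a) = cong suc (adjacent-toℕ a)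

adjacent-≢ : ∀ {n} {c d : Fin n} → Adjacent c d → c ≢ d
adjacent-≢ a refl = ℕ.1+n≢n (sym (adjacent-toℕ a))

signFin-suc : ∀ {n} (j : Fin n) → signFin (suc j) ≡ - signFin j
signFin-suc zero          = refl
signFin-suc (suc zero)    = refl
signFin-suc (suc (suc j)) = signFin-suc j

adjacent-signFin : ∀ {n} {c d : Fin n} → Adjacent c d → signFin d ≡ - signFin c
adjacent-signFin zero-one = refl
adjacent-signFin {c = suc c} {suc d} (suc-suc a) = begin
  signFin (suc d)   ≡⟨ signFin-suc d ⟩
  - signFin d       ≡⟨ cong -_ (adjacent-signFin a) ⟩
  - - signFin c     ≡⟨ cong -_ (sym (signFin-suc c)) ⟩
  - signFin (suc c) ∎
  where open ≡-Reasoning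

adjacent-punchIn : ∀ {n} {c d : Fin (suc n)} → Adjacent c d → ∀ x →
  punchIn c x ≡ punchIn d x ⊎ (punchIn c x ≡ d × punchIn d x ≡ c)
adjacent-punchIn zero-one zero    = inj₂ (refl , refl)
adjacent-punchIn zero-one (suc x) = inj₁ refl
adjacent-punchIn (suc-suc a) zero = inj₁ refl
adjacent-punchIn (suc-suc a) (suc x) with adjacent-punchIn a x
... | inj₁ e         = inj₁ (cong suc e)
... | inj₂ (e₁ , e₂) = inj₂ (cong suc e₁ , cong suc e₂)

adjacent-punchOut : ∀ {n} {c d j : Fin (suc n)} → Adjacent c d → (j≢c : j ≢ c) (j≢d : j ≢ d) →
  Adjacent (punchOut j≢c) (punchOut j≢d)
adjacent-punchOut {j = zero}     zero-one j≢c j≢d = ⊥-elim (j≢c refl)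
adjacent-punchOut {j = suc zero} zero-one j≢c j≢d = ⊥-elim (j≢d refl)
adjacent-punchOut {suc (suc n)} {j = suc (suc j)} zero-one j≢c j≢d = zero-one
adjacent-punchOut {j = zero} (suc-suc a) j≢c j≢d = a
adjacent-punchOut {suc (suc n)} {j = suc j} (suc-suc a) j≢c j≢d =
  suc-suc (adjacent-punchOut a (j≢c ∘ cong suc) (j≢d ∘ cong suc))
adjacent-punchOut {suc zero} {j = suc j} (suc-suc (suc-suc {c = ()} a)) j≢c j≢d

term-neg-det : ∀ s x D D′ → D ≡ - D′ → -1ℤ * (s * (x * D)) ≡ s * (x * D′)
term-neg-det s x D D′ refl = solve 3 (λ s x D → con -1ℤ :* (s :* (x :* (:- D))) := s :* (x :* D)) refl s x D′

term-neg-sign : ∀ s s′ x D → s ≡ - s′ → -1ℤ * (s * (x * D)) ≡ s′ * (x * D)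
term-neg-sign s s′ x D refl = solve 3 (λ s x D → con -1ℤ :* ((:- s) :* (x :* D)) := s :* (x :* D)) refl s′ x D

det-swap-adjacent : ∀ {n} {c d : Fin n} → Adjacent c d → (K M : Matrix n) →
  (∀ r j → j ≢ c → j ≢ d → K r j ≡ M r j) → (∀ r → K r c ≡ M r d) → (∀ r → K r d ≡ M r c) →
  det K ≡ - det M
det-swap-adjacent {suc n} {c} {d} a K M K≗M Kc Kd = begin
  det K                                   ≡⟨ sym (ℤ.neg-involutive (det K)) ⟩
  - - det K                               ≡⟨ cong -_ (sym (ℤ.-1*i≡-i (det K))) ⟩
  - (-1ℤ * det K)                         ≡⟨ cong -_ (sym (sumFin-*ˡ -1ℤ (laplaceTerm K))) ⟩
  - sumFin (λ j → -1ℤ * laplaceTerm K j)  ≡⟨ cong -_ (sumFin-transpose (laplaceTerm M) (λ j → -1ℤ * laplaceTerm K j)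
                                                        (adjacent-≢ a) off at-c at-d) ⟩
  - det M                                 ∎
  where
  open ≡-Reasoning
  off : ∀ j → j ≢ c → j ≢ d → -1ℤ * laplaceTerm K j ≡ laplaceTerm M j
  off j j≢c j≢d = trans
    (term-neg-det (signFin j) (K zero j) (det (minor K zero j)) (det (minor M zero j))
      (det-swap-adjacent (adjacent-punchOut a j≢c j≢d) (minor K zero j) (minor M zero j)
        (λ r x x≢c x≢d → K≗M (suc r) (punchIn j x) (punchIn-≢ j≢c x≢c) (punchIn-≢ j≢d x≢d))
        (λ r → trans (cong (K (suc r)) (Fin.punchIn-punchOut j≢c))
                     (trans (Kc (suc r)) (cong (M (suc r)) (sym (Fin.punchIn-punchOut j≢d)))))
        (λ r → trans (cong (K (suc r)) (Fin.punchIn-punchOut j≢d))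
                     (trans (Kd (suc r)) (cong (M (suc r)) (sym (Fin.punchIn-punchOut j≢c)))))))
    (cong (λ x → signFin j * (x * det (minor M zero j))) (K≗M zero j j≢c j≢d))
  minors-swapped : ∀ r x → minor K zero c r x ≡ minor M zero d r x × minor K zero d r x ≡ minor M zero c r x
  minors-swapped r x with adjacent-punchIn a x
  ... | inj₁ e =
    let x≢c = Fin.punchInᵢ≢i c x
        x≢d = subst (_≢ d) (sym e) (Fin.punchInᵢ≢i d x)
    in trans (K≗M (suc r) _ x≢c x≢d) (cong (M (suc r)) e) ,
       trans (cong (K (suc r)) (sym e)) (K≗M (suc r) _ x≢c x≢d)
  ... | inj₂ (e₁ , e₂) =
    trans (cong (K (suc r)) e₁) (trans (Kd (suc r)) (cong (M (suc r)) (sym e₂))) ,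
    trans (cong (K (suc r)) e₂) (trans (Kc (suc r)) (cong (M (suc r)) (sym e₁)))
  signs = adjacent-signFin a
  at-c : -1ℤ * laplaceTerm K c ≡ laplaceTerm M d
  at-c = trans (cong₂ (λ x D → -1ℤ * (signFin c * (x * D))) (Kc zero) (det-cong (λ r x → proj₁ (minors-swapped r x))))
    (term-neg-sign (signFin c) (signFin d) (M zero d) (det (minor M zero d))
      (trans (sym (ℤ.neg-involutive (signFin c))) (cong -_ (sym signs))))
  at-d : -1ℤ * laplaceTerm K d ≡ laplaceTerm M c
  at-d = trans (cong₂ (λ x D → -1ℤ * (signFin d * (x * D))) (Kd zero) (det-cong (λ r x → proj₂ (minors-swapped r x))))
    (term-neg-sign (signFin d) (signFin c) (M zero c) (det (minor M zero c)) signs)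

x≡-x⇒x≡0 : ∀ x → x ≡ - x → x ≡ 0ℤ
x≡-x⇒x≡0 x x≡-x = ℤ.*-cancelˡ-≡ 2ℤ x 0ℤ (begin
  2ℤ * x   ≡⟨ solve 1 (λ x → con 2ℤ :* x := x :+ x) refl x ⟩
  x + x       ≡⟨ cong (x +_) x≡-x ⟩
  x + - x     ≡⟨ ℤ.+-inverseʳ x ⟩
  0ℤ          ∎)
  where open ≡-Reasoning

det-equal-adjacent-columns : ∀ {n} (M : Matrix n) {c d : Fin n} → Adjacent c d →
                             (∀ r → M r c ≡ M r d) → det M ≡ 0ℤ
det-equal-adjacent-columns M a Mc≗Md = x≡-x⇒x≡0 (det M)
  (det-swap-adjacent a M M (λ _ _ _ _ → refl) Mc≗Md (sym ∘ Mc≗Md))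

adjacent-predecessor : ∀ {n} (d : Fin n) → 0 ℕ.< toℕ d → ∃ λ d′ → Adjacent d′ d
adjacent-predecessor (suc zero)    _ = zero , zero-one
adjacent-predecessor (suc (suc d)) _ with adjacent-predecessor (suc d) (ℕ.s≤s ℕ.z≤n)
... | d′ , a = suc d′ , suc-suc a

module _ {n} (i j : Fin n) where

  transpose-left : transpose i j i ≡ j
  transpose-left rewrite dec-true (i ≟ i) refl = refl

  transpose-right : transpose i j j ≡ i
  transpose-right with j ≟ i
  ... | yes j≡i = j≡i
  ... | no _ rewrite dec-true (j ≟ j) refl = refl

  transpose-other : ∀ {k} → k ≢ i → k ≢ j → transpose i j k ≡ k
  transpose-other {k} k≢i k≢j rewrite dec-false (k ≟ i) k≢i | dec-false (k ≟ j) k≢j = refl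

det-equal-columns-< : ∀ g {n} (M : Matrix n) {c d : Fin n} → toℕ d ≡ g → toℕ c ℕ.< toℕ d →
                      (∀ r → M r c ≡ M r d) → det M ≡ 0ℤ
det-equal-columns-< zero M {c} d≡0 c<d Mc≗Md = ⊥-elim (ℕ.n≮0 (subst (toℕ c ℕ.<_) d≡0 c<d))
det-equal-columns-< (suc g) M {c} {d} d≡1+g c<d Mc≗Md
  with adjacent-predecessor d (ℕ.<-≤-trans (ℕ.s≤s ℕ.z≤n) c<d)
... | d′ , a with toℕ c ℕ.≟ toℕ d′
...   | yes c≡d′ = det-equal-adjacent-columns M (subst (λ z → Adjacent z d) (sym (Fin.toℕ-injective c≡d′)) a) Mc≗Md
...   | no toℕc≢toℕd′ = begin
  det M       ≡⟨ sym (ℤ.neg-involutive (det M)) ⟩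
  - - det M   ≡⟨ cong -_ (sym det-K) ⟩
  - det K     ≡⟨ cong -_ det-K≡0 ⟩
  - 0ℤ        ∎
  where
  open ≡-Reasoning
  d≡1+d′ = adjacent-toℕ a
  c≢d : c ≢ d
  c≢d e = ℕ.<-irrefl (cong toℕ e) c<d
  c≢d′ : c ≢ d′
  c≢d′ = toℕc≢toℕd′ ∘ cong toℕ
  K : Matrix _
  K r k = M r (transpose d′ d k)
  det-K : det K ≡ - det M
  det-K = det-swap-adjacent a K M (λ r j j≢d′ j≢d → cong (M r) (transpose-other d′ d j≢d′ j≢d))
            (λ r → cong (M r) (transpose-left d′ d)) (λ r → cong (M r) (transpose-right d′ d))
  det-K≡0 : det K ≡ 0ℤ
  det-K≡0 = det-equal-columns-< g K (ℕ.suc-injective (trans (sym d≡1+d′) d≡1+g))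
    (ℕ.≤∧≢⇒< (ℕ.s≤s⁻¹ (subst (toℕ c ℕ.<_) d≡1+d′ c<d)) toℕc≢toℕd′)
    (λ r → trans (cong (M r) (transpose-other d′ d c≢d′ c≢d))
                 (trans (Mc≗Md r) (sym (cong (M r) (transpose-left d′ d)))))

det-equal-columns : ∀ {n} (M : Matrix n) {c d : Fin n} → c ≢ d → (∀ r → M r c ≡ M r d) → det M ≡ 0ℤ
det-equal-columns M {c} {d} c≢d Mc≗Md with ℕ.<-cmp (toℕ c) (toℕ d)
... | tri< c<d _ _ = det-equal-columns-< (toℕ d) M refl c<d Mc≗Md
... | tri≈ _ c≡d _ = ⊥-elim (c≢d (Fin.toℕ-injective c≡d))
... | tri> _ _ d<c = det-equal-columns-< (toℕ c) M refl d<c (sym ∘ Mc≗Md)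

det-add-column-multiple : ∀ {n} {s t : Fin n} (u : ℤ) (K M : Matrix n) → s ≢ t →
  (∀ r j → j ≢ t → K r j ≡ M r j) → (∀ r → K r t ≡ M r t + u * M r s) → det K ≡ det M
det-add-column-multiple {s = s} {t} u K M s≢t K≗M Kt = begin
  det K              ≡⟨ det-linear-column t u K M N K≗M K≗N
                          (λ r → trans (Kt r) (cong (λ x → M r t + u * x) (sym (Nt r)))) ⟩
  det M + u * det N  ≡⟨ cong (λ x → det M + u * x) (det-equal-columns N s≢t (λ r → trans (Ns r) (sym (Nt r)))) ⟩
  det M + u * 0ℤ     ≡⟨ cong (det M +_) (ℤ.*-zeroʳ u) ⟩
  det M + 0ℤ         ≡⟨ ℤ.+-identityʳ (det M) ⟩
  det M              ∎
  where
  open ≡-Reasoning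
  N : Matrix _
  N r j = M r (if does (j ≟ t) then s else j)
  Nt : ∀ r → N r t ≡ M r s
  Nt r rewrite dec-true (t ≟ t) refl = refl
  N-off : ∀ r j → j ≢ t → N r j ≡ M r j
  N-off r j j≢t rewrite dec-false (j ≟ t) j≢t = refl
  Ns : ∀ r → N r s ≡ M r s
  Ns r = N-off r s s≢t
  K≗N : ∀ r j → j ≢ t → K r j ≡ N r j
  K≗N r j j≢t = trans (K≗M r j j≢t) (sym (N-off r j j≢t))

module _ {n} (M : Matrix n) (q : Fin n) (λ′ : Fin n → ℤ) (λ′q≡0 : λ′ q ≡ 0ℤ) where

  private
    coef : ℕ → Fin n → ℤ
    coef g l with toℕ l ℕ.<? g
    ... | yes _ = λ′ l
    ... | no  _ = 0ℤ

    partial : ℕ → Matrix n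
    partial g r l = M r l + coef g l * M r q

    coef-q : ∀ g → coef g q ≡ 0ℤ
    coef-q g with toℕ q ℕ.<? g
    ... | yes _ = λ′q≡0
    ... | no  _ = refl

    partial-q : ∀ g r → partial g r q ≡ M r q
    partial-q g r = trans (cong (λ x → M r q + x * M r q) (coef-q g)) (ℤ.+-identityʳ (M r q))

    coef-suc : ∀ g l → toℕ l ≢ g → coef (suc g) l ≡ coef g l
    coef-suc g l l≢g with toℕ l ℕ.<? suc g | toℕ l ℕ.<? g
    ... | yes _      | yes _   = refl
    ... | no  _      | no  _   = refl
    ... | yes l<1+g  | no  l≮g = ⊥-elim (l≮g (ℕ.≤∧≢⇒< (ℕ.s≤s⁻¹ l<1+g) l≢g))
    ... | no  l≮1+g  | yes l<g = ⊥-elim (l≮1+g (ℕ.m<n⇒m<1+n l<g))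

    coef-at : ∀ g l → toℕ l ≡ g → coef (suc g) l ≡ λ′ l × coef g l ≡ 0ℤ
    coef-at g l l≡g with toℕ l ℕ.<? suc g | toℕ l ℕ.<? g
    ... | yes _     | no _    = refl , refl
    ... | no  l≮1+g | _       = ⊥-elim (l≮1+g (ℕ.s≤s (ℕ.≤-reflexive l≡g)))
    ... | _         | yes l<g = ⊥-elim (ℕ.<-irrefl l≡g l<g)

    partial-suc : ∀ g → det (partial (suc g)) ≡ det (partial g)
    partial-suc g with g ℕ.<? n
    ... | no g≮n = det-cong λ r l →
          cong (λ x → M r l + x * M r q) (coef-suc g l (λ l≡g → g≮n (subst (ℕ._< n) l≡g (Fin.toℕ<n l))))
    ... | yes g<n = by-cases (l₀ ≟ q)
      where
      open ≡-Reasoning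
      l₀ = Fin.fromℕ< g<n
      at-g : ∀ {l} → toℕ l ≡ g → l ≡ l₀
      at-g l≡g = Fin.toℕ-injective (trans l≡g (sym (Fin.toℕ-fromℕ< g<n)))
      at-l₀ = coef-at g l₀ (Fin.toℕ-fromℕ< g<n)
      no-op : ∀ {r} → partial g r l₀ ≡ M r l₀
      no-op {r} = trans (cong (λ x → M r l₀ + x * M r q) (proj₂ at-l₀)) (ℤ.+-identityʳ (M r l₀))
      same-coef : l₀ ≡ q → ∀ l → coef (suc g) l ≡ coef g l
      same-coef l₀≡q l with l ≟ q
      ... | yes refl = trans (coef-q (suc g)) (sym (coef-q g))
      ... | no  l≢q  = coef-suc g l (λ l≡g → l≢q (trans (at-g l≡g) l₀≡q))
      by-cases : Dec (l₀ ≡ q) → det (partial (suc g)) ≡ det (partial g)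
      by-cases (yes l₀≡q) = det-cong λ r l → cong (λ x → M r l + x * M r q) (same-coef l₀≡q l)
      by-cases (no  l₀≢q) = det-add-column-multiple (λ′ l₀) (partial (suc g)) (partial g) (l₀≢q ∘ sym)
        (λ r l l≢l₀ → cong (λ x → M r l + x * M r q) (coef-suc g l (l≢l₀ ∘ at-g)))
        (λ r → begin
          M r l₀ + coef (suc g) l₀ * M r q        ≡⟨ cong (λ x → M r l₀ + x * M r q) (proj₁ at-l₀) ⟩
          M r l₀ + λ′ l₀ * M r q                  ≡⟨ cong₂ (λ x y → x + λ′ l₀ * y) (sym no-op) (sym (partial-q g r)) ⟩
          partial g r l₀ + λ′ l₀ * partial g r q  ∎)

    partial-det : ∀ g → det (partial g) ≡ det M
    partial-det zero    = det-cong λ r l → ℤ.+-identityʳ (M r l)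
    partial-det (suc g) = trans (partial-suc g) (partial-det g)

  det-add-multiples-of-column : det (λ r l → M r l + λ′ l * M r q) ≡ det M
  det-add-multiples-of-column =
    trans (det-cong λ r l → cong (λ x → M r l + x * M r q) (sym (coef-all l))) (partial-det n)
    where
    coef-all : ∀ l → coef n l ≡ λ′ l
    coef-all l with toℕ l ℕ.<? n
    ... | yes _   = refl
    ... | no  l≮n = ⊥-elim (l≮n (Fin.toℕ<n l))

det-zero-row : ∀ {n} (M : Matrix n) (i : Fin n) → (∀ j → M i j ≡ 0ℤ) → det M ≡ 0ℤ
det-zero-row M i Mi≡0 = trans
  (det-linear-row i -1ℤ M M M (λ _ _ _ → refl) (λ _ _ _ → refl)
                  (λ j → subst (λ x → x ≡ x + -1ℤ * x) (sym (Mi≡0 j)) refl))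
  (trans (cong (det M +_) (ℤ.-1*i≡-i (det M))) (ℤ.+-inverseʳ (det M)))

signFin≡-1^toℕ : ∀ {n} (j : Fin n) → signFin j ≡ -1ℤ ^ toℕ j
signFin≡-1^toℕ zero          = refl
signFin≡-1^toℕ (suc zero)    = refl
signFin≡-1^toℕ (suc (suc j)) = trans (signFin≡-1^toℕ j)
  (solve 1 (λ x → x := con -1ℤ :* (con -1ℤ :* x)) refl (-1ℤ ^ toℕ j))

-1^n*-1^n≡1 : ∀ n → -1ℤ ^ n * -1ℤ ^ n ≡ 1ℤ
-1^n*-1^n≡1 zero    = refl
-1^n*-1^n≡1 (suc n) =
  trans (solve 1 (λ s → (con -1ℤ :* s) :* (con -1ℤ :* s) := s :* s) refl (-1ℤ ^ n)) (-1^n*-1^n≡1 n)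

punchIn-punchOut-sign : ∀ {n} (c : Fin (suc (suc n))) (j : Fin (suc n)) (j≢c : punchIn c j ≢ c) →
  -1ℤ ^ toℕ (punchIn c j) * -1ℤ ^ toℕ (punchOut j≢c) ≡ - (-1ℤ ^ toℕ c * -1ℤ ^ toℕ j)
punchIn-punchOut-sign zero j _ =
  solve 1 (λ x → (con -1ℤ :* x) :* con 1ℤ := :- (con 1ℤ :* x)) refl (-1ℤ ^ toℕ j)
punchIn-punchOut-sign (suc c) zero _ =
  solve 1 (λ x → con 1ℤ :* x := :- ((con -1ℤ :* x) :* con 1ℤ)) refl (-1ℤ ^ toℕ c)
punchIn-punchOut-sign {suc n} (suc c) (suc j) j≢c = begin
  (-1ℤ * -1ℤ ^ toℕ (punchIn c j)) * (-1ℤ * -1ℤ ^ toℕ (punchOut j≢c′))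
    ≡⟨ solve 2 (λ x y → (con -1ℤ :* x) :* (con -1ℤ :* y) := x :* y) refl
               (-1ℤ ^ toℕ (punchIn c j)) (-1ℤ ^ toℕ (punchOut j≢c′)) ⟩
  -1ℤ ^ toℕ (punchIn c j) * -1ℤ ^ toℕ (punchOut j≢c′)
    ≡⟨ punchIn-punchOut-sign c j j≢c′ ⟩
  - (-1ℤ ^ toℕ c * -1ℤ ^ toℕ j)
    ≡⟨ solve 2 (λ x y → :- (x :* y) := :- ((con -1ℤ :* x) :* (con -1ℤ :* y))) refl
               (-1ℤ ^ toℕ c) (-1ℤ ^ toℕ j) ⟩
  - ((-1ℤ * -1ℤ ^ toℕ c) * (-1ℤ * -1ℤ ^ toℕ j)) ∎
  where
  open ≡-Reasoning
  j≢c′ = j≢c ∘ cong suc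

punchIn-punchIn-punchOut : ∀ {n} (c : Fin (suc (suc n))) (j : Fin (suc n)) (j≢c : punchIn c j ≢ c) (v : Fin n) →
  punchIn (punchIn c j) (punchIn (punchOut j≢c) v) ≡ punchIn c (punchIn j v)
punchIn-punchIn-punchOut zero j j≢c v = refl
punchIn-punchIn-punchOut (suc c) zero j≢c v = refl
punchIn-punchIn-punchOut {suc n} (suc c) (suc j) j≢c zero = refl
punchIn-punchIn-punchOut {suc n} (suc c) (suc j) j≢c (suc v) = cong suc (punchIn-punchIn-punchOut c j (j≢c ∘ cong suc) v)

det-expand-row : ∀ {n} (M : Matrix (suc n)) (r c : Fin (suc n)) → (∀ j → j ≢ c → M r j ≡ 0ℤ) →
                 det M ≡ -1ℤ ^ (toℕ r ℕ.+ toℕ c) * (M r c * det (minor M r c))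
det-expand-row M zero c Mr≡0 = trans
  (sumFin-single (laplaceTerm M) c λ j j≢c →
     trans (cong (λ x → signFin j * (x * det (minor M zero j))) (Mr≡0 j j≢c)) (ℤ.*-zeroʳ (signFin j)))
  (cong (_* (M zero c * det (minor M zero c))) (signFin≡-1^toℕ c))
det-expand-row {suc n} M (suc r) c Mr≡0 = begin
  det M
    ≡⟨ sumFin-punchIn (laplaceTerm M) c ⟩
  laplaceTerm M c + sumFin (laplaceTerm M ∘ punchIn c)
    ≡⟨ cong₂ _+_ term-c (sumFin-cong term-punchIn) ⟩
  0ℤ + sumFin (λ j′ → σ * laplaceTerm (minor M (suc r) c) j′)
    ≡⟨ ℤ.+-identityˡ (sumFin (λ j′ → σ * laplaceTerm (minor M (suc r) c) j′)) ⟩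
  sumFin (λ j′ → σ * laplaceTerm (minor M (suc r) c) j′)
    ≡⟨ sumFin-*ˡ σ (laplaceTerm (minor M (suc r) c)) ⟩
  σ * det (minor M (suc r) c)
    ≡⟨ ℤ.*-assoc (-1ℤ ^ (toℕ (suc r) ℕ.+ toℕ c)) (M (suc r) c) (det (minor M (suc r) c)) ⟩
  -1ℤ ^ (toℕ (suc r) ℕ.+ toℕ c) * (M (suc r) c * det (minor M (suc r) c)) ∎
  where
  open ≡-Reasoning
  σ = -1ℤ ^ (toℕ (suc r) ℕ.+ toℕ c) * M (suc r) c
  term-c : laplaceTerm M c ≡ 0ℤ
  term-c = trans (cong (λ x → signFin c * (M zero c * x))
                       (det-zero-row (minor M zero c) r (λ x → Mr≡0 (punchIn c x) (Fin.punchInᵢ≢i c x))))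
                 (trans (cong (signFin c *_) (ℤ.*-zeroʳ (M zero c))) (ℤ.*-zeroʳ (signFin c)))
  term-punchIn : ∀ j′ → laplaceTerm M (punchIn c j′) ≡ σ * laplaceTerm (minor M (suc r) c) j′
  term-punchIn j′ = begin
    signFin j * (M zero j * det (minor M zero j))
      ≡⟨ cong (λ x → signFin j * (M zero j * x)) expand-minor ⟩
    signFin j * (M zero j * (-1ℤ ^ (toℕ r ℕ.+ toℕ cⱼ) * (M (suc r) c * D)))
      ≡⟨ solve 5 (λ s m σ′ x D → s :* (m :* (σ′ :* (x :* D))) := (s :* σ′) :* (x :* (m :* D))) refl
               (signFin j) (M zero j) (-1ℤ ^ (toℕ r ℕ.+ toℕ cⱼ)) (M (suc r) c) D ⟩
    (signFin j * -1ℤ ^ (toℕ r ℕ.+ toℕ cⱼ)) * (M (suc r) c * (M zero j * D))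
      ≡⟨ cong (λ s → s * (M (suc r) c * (M zero j * D))) signs ⟩
    (-1ℤ ^ (toℕ (suc r) ℕ.+ toℕ c) * signFin j′) * (M (suc r) c * (M zero j * D))
      ≡⟨ solve 4 (λ σ′ s x y → (σ′ :* s) :* (x :* y) := (σ′ :* x) :* (s :* y)) refl
               (-1ℤ ^ (toℕ (suc r) ℕ.+ toℕ c)) (signFin j′) (M (suc r) c) (M zero j * D) ⟩
    σ * laplaceTerm (minor M (suc r) c) j′ ∎
    where
    j = punchIn c j′
    j≢c = Fin.punchInᵢ≢i c j′
    cⱼ = punchOut j≢c
    D = det (minor (minor M (suc r) c) zero j′)
    expand-minor : det (minor M zero j) ≡ -1ℤ ^ (toℕ r ℕ.+ toℕ cⱼ) * (M (suc r) c * D)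
    expand-minor = trans
      (det-expand-row (minor M zero j) r cⱼ (λ x x≢ → Mr≡0 (punchIn j x) (punchIn-≢ j≢c x≢)))
      (cong₂ (λ x y → -1ℤ ^ (toℕ r ℕ.+ toℕ cⱼ) * (x * y))
        (cong (M (suc r)) (Fin.punchIn-punchOut j≢c))
        (det-cong λ u v → cong (M (suc (punchIn r u))) (punchIn-punchIn-punchOut c j′ j≢c v)))
    signs : signFin j * -1ℤ ^ (toℕ r ℕ.+ toℕ cⱼ) ≡ -1ℤ ^ (toℕ (suc r) ℕ.+ toℕ c) * signFin j′
    signs = begin
      signFin j * -1ℤ ^ (toℕ r ℕ.+ toℕ cⱼ)
        ≡⟨ cong₂ _*_ (signFin≡-1^toℕ j) (ℤ.^-distribˡ-+-* -1ℤ (toℕ r) (toℕ cⱼ)) ⟩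
      -1ℤ ^ toℕ j * (-1ℤ ^ toℕ r * -1ℤ ^ toℕ cⱼ)
        ≡⟨ solve 3 (λ a b c → a :* (b :* c) := b :* (a :* c)) refl
                   (-1ℤ ^ toℕ j) (-1ℤ ^ toℕ r) (-1ℤ ^ toℕ cⱼ) ⟩
      -1ℤ ^ toℕ r * (-1ℤ ^ toℕ j * -1ℤ ^ toℕ cⱼ)
        ≡⟨ cong (-1ℤ ^ toℕ r *_) (punchIn-punchOut-sign c j′ j≢c) ⟩
      -1ℤ ^ toℕ r * - (-1ℤ ^ toℕ c * -1ℤ ^ toℕ j′)
        ≡⟨ solve 3 (λ a b c → a :* (:- (b :* c)) := (con -1ℤ :* (a :* b)) :* c) refl
                   (-1ℤ ^ toℕ r) (-1ℤ ^ toℕ c) (-1ℤ ^ toℕ j′) ⟩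
      (-1ℤ * (-1ℤ ^ toℕ r * -1ℤ ^ toℕ c)) * -1ℤ ^ toℕ j′
        ≡⟨ cong₂ (λ x y → -1ℤ * x * y)
                 (sym (ℤ.^-distribˡ-+-* -1ℤ (toℕ r) (toℕ c))) (sym (signFin≡-1^toℕ j′)) ⟩
      -1ℤ ^ (toℕ (suc r) ℕ.+ toℕ c) * signFin j′ ∎

-- Linear orders

record LinearOrder : Set where
  field
    lt        : ℕ → ℕ → Bool
    lt-irrefl : ∀ x → lt x x ≡ false
    lt-trans  : ∀ x y z → lt x y ≡ true → lt y z ≡ true → lt x z ≡ true
    lt-connex : ∀ x y → x ≢ y → lt x y ≡ false → lt y x ≡ true

  lt-asym : ∀ x y → lt x y ≡ true → lt y x ≡ false
  lt-asym x y x<y with lt y x in y<x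
  ... | true  with () ← trans (sym (lt-irrefl x)) (lt-trans x y x x<y y<x)
  ... | false = refl

  lt-flip : ∀ x y → x ≢ y → lt y x ≡ not (lt x y)
  lt-flip x y x≢y with lt x y in x<y
  ... | true  = lt-asym x y x<y
  ... | false = lt-connex x y x≢y x<y

open LinearOrder public

χ : LinearOrder → ℕ → ℕ → ℤ
χ o x y = bool→ℤ (lt o x y)

sgn : LinearOrder → ℕ → ℕ → ℤ
sgn o x y = χ o x y - χ o y x

bool→ℤ-not : ∀ b → bool→ℤ (not b) ≡ 1ℤ - bool→ℤ b
bool→ℤ-not true  = refl
bool→ℤ-not false = refl

χ-flip : ∀ o {x y} → x ≢ y → χ o y x ≡ 1ℤ - χ o x y
χ-flip o {x} {y} x≢y = trans (cong bool→ℤ (lt-flip o x y x≢y)) (bool→ℤ-not (lt o x y))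

sgn≡2χ-1 : ∀ o {x y} → x ≢ y → sgn o x y ≡ 2ℤ * χ o x y - 1ℤ
sgn≡2χ-1 o {x} {y} x≢y = trans (cong (λ c → χ o x y - c) (χ-flip o x≢y))
  (solve 1 (λ c → c :- (con 1ℤ :- c) := con 2ℤ :* c :- con 1ℤ) refl (χ o x y))

sgn-antisym : ∀ o x y → sgn o y x ≡ - sgn o x y
sgn-antisym o x y = solve 2 (λ a b → b :- a := :- (a :- b)) refl (χ o x y) (χ o y x)

sgn-lt : ∀ o {x y} → lt o x y ≡ true → sgn o x y ≡ 1ℤ
sgn-lt o {x} {y} x<y rewrite x<y | lt-asym o x y x<y = refl

sgn-gt : ∀ o {x y} → lt o y x ≡ true → sgn o x y ≡ -1ℤ
sgn-gt o {x} {y} y<x rewrite y<x | lt-asym o y x y<x = refl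

<ᵇ≡true⇒< : ∀ {m n} → (m ℕ.<ᵇ n) ≡ true → m ℕ.< n
<ᵇ≡true⇒< {m} {n} m<ᵇn = ℕ.<ᵇ⇒< m n (subst Bool.T (sym m<ᵇn) _)

ℕ-order : LinearOrder
ℕ-order = record
  { lt        = ℕ._<ᵇ_
  ; lt-irrefl = λ x → dec-false (x ℕ.<? x) (ℕ.<-irrefl refl)
  ; lt-trans  = λ x y z x<y y<z → dec-true (x ℕ.<? z) (ℕ.<-trans (<ᵇ≡true⇒< x<y) (<ᵇ≡true⇒< y<z))
  ; lt-connex = λ x y x≢y x≮y → dec-true (y ℕ.<? x)
      (ℕ.≤∧≢⇒< (ℕ.≮⇒≥ (λ x<y → contradiction (trans (sym x≮y) (dec-true (x ℕ.<? y) x<y)) λ ()))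
               (x≢y ∘ sym))
  }

lexLt : LinearOrder → (ℕ → ℕ) → ℕ → ℕ → Bool
lexLt o β x y with ℕ.<-cmp (β x) (β y)
... | tri< _ _ _ = true
... | tri≈ _ _ _ = lt o x y
... | tri> _ _ _ = false

module _ (o : LinearOrder) (β : ℕ → ℕ) where

  lexLt-< : ∀ {x y} → β x ℕ.< β y → lexLt o β x y ≡ true
  lexLt-< {x} {y} βx<βy with ℕ.<-cmp (β x) (β y)
  ... | tri< _ _ _     = refl
  ... | tri≈ βx≮βy _ _ = ⊥-elim (βx≮βy βx<βy)
  ... | tri> βx≮βy _ _ = ⊥-elim (βx≮βy βx<βy)

  lexLt-≡ : ∀ {x y} → β x ≡ β y → lexLt o β x y ≡ lt o x y
  lexLt-≡ {x} {y} βx≡βy with ℕ.<-cmp (β x) (β y)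
  ... | tri< _ βx≢βy _ = ⊥-elim (βx≢βy βx≡βy)
  ... | tri≈ _ _ _     = refl
  ... | tri> _ βx≢βy _ = ⊥-elim (βx≢βy βx≡βy)

  lexLt-true : ∀ {x y} → lexLt o β x y ≡ true → β x ℕ.< β y ⊎ (β x ≡ β y × lt o x y ≡ true)
  lexLt-true {x} {y} x<y with ℕ.<-cmp (β x) (β y)
  ... | tri< βx<βy _ _ = inj₁ βx<βy
  ... | tri≈ _ βx≡βy _ = inj₂ (βx≡βy , x<y)

  lexOrder : LinearOrder
  lexOrder = record { lt = lexLt o β ; lt-irrefl = irrefl ; lt-trans = transitive ; lt-connex = connex }
    where
    irrefl : ∀ x → lexLt o β x x ≡ false
    irrefl x = trans (lexLt-≡ refl) (lt-irrefl o x)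
    transitive : ∀ x y z → lexLt o β x y ≡ true → lexLt o β y z ≡ true → lexLt o β x z ≡ true
    transitive x y z x<y y<z with lexLt-true x<y | lexLt-true y<z
    ... | inj₁ p        | inj₁ q        = lexLt-< (ℕ.<-trans p q)
    ... | inj₁ p        | inj₂ (e , _)  = lexLt-< (subst (β x ℕ.<_) e p)
    ... | inj₂ (e , _)  | inj₁ q        = lexLt-< (subst (ℕ._< β z) (sym e) q)
    ... | inj₂ (e , p)  | inj₂ (e′ , q) = trans (lexLt-≡ (trans e e′)) (lt-trans o x y z p q)
    connex : ∀ x y → x ≢ y → lexLt o β x y ≡ false → lexLt o β y x ≡ true
    connex x y x≢y x≮y with ℕ.<-cmp (β x) (β y)
    ... | tri> _ _ βy<βx = lexLt-< βy<βx
    ... | tri≈ _ βx≡βy _ = trans (lexLt-≡ (sym βx≡βy)) (lt-connex o x y x≢y x≮y)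

  sgn-lex-≡ : ∀ {x y} → β x ≡ β y → sgn lexOrder x y ≡ sgn o x y
  sgn-lex-≡ βx≡βy = cong₂ (λ u v → bool→ℤ u - bool→ℤ v) (lexLt-≡ βx≡βy) (lexLt-≡ (sym βx≡βy))

sgn-refining : ∀ o (β : ℕ → ℕ) → (∀ {x y} → β x ℕ.< β y → lt o x y ≡ true) →
               ∀ {x y} → β x ≢ β y → sgn o x y ≡ sgn ℕ-order (β x) (β y)
sgn-refining o β refines {x} {y} βx≢βy with ℕ.<-cmp (β x) (β y)
... | tri< βx<βy _ _ =
  trans (sgn-lt o (refines βx<βy)) (sym (sgn-lt ℕ-order {β x} {β y} (dec-true (β x ℕ.<? β y) βx<βy)))
... | tri≈ _ βx≡βy _ = ⊥-elim (βx≢βy βx≡βy)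
... | tri> _ _ βy<βx =
  trans (sgn-gt o (refines βy<βx)) (sym (sgn-gt ℕ-order {β x} {β y} (dec-true (β y ℕ.<? β x) βy<βx)))

-- Chord diagrams and their interlace matrices

IsZeroOrUnit : ℤ → Set
IsZeroOrUnit z = z ≡ 0ℤ ⊎ z ≡ 1ℤ ⊎ z ≡ -1ℤ

IsZeroOrUnit-≢0 : ∀ {z} → IsZeroOrUnit z → z ≢ 0ℤ → z ≡ 1ℤ ⊎ z ≡ -1ℤ
IsZeroOrUnit-≢0 (inj₁ z≡0)  z≢0 = ⊥-elim (z≢0 z≡0)
IsZeroOrUnit-≢0 (inj₂ z≡±1) _   = z≡±1

IsZeroOrUnit-neg : ∀ {z} → IsZeroOrUnit z → IsZeroOrUnit (- z)
IsZeroOrUnit-neg (inj₁ refl)        = inj₁ refl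
IsZeroOrUnit-neg (inj₂ (inj₁ refl)) = inj₂ (inj₂ refl)
IsZeroOrUnit-neg (inj₂ (inj₂ refl)) = inj₂ (inj₁ refl)

IsZeroOrUnit-square : ∀ {z} → IsZeroOrUnit z → z ≢ 0ℤ → z * z ≡ 1ℤ
IsZeroOrUnit-square (inj₁ refl)        z≢0 = ⊥-elim (z≢0 refl)
IsZeroOrUnit-square (inj₂ (inj₁ refl)) _   = refl
IsZeroOrUnit-square (inj₂ (inj₂ refl)) _   = refl

-- ±1 if the chords {α₁, α₂} and {γ₁, γ₂} interleave, the sign recording their orientations; 0 otherwise.
crossing : LinearOrder → ℕ → ℕ → ℕ → ℕ → ℤ
crossing o α₁ α₂ γ₁ γ₂ = χ o α₁ γ₁ - χ o α₁ γ₂ - χ o α₂ γ₁ + χ o α₂ γ₂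

crossingSgn : LinearOrder → ℕ → ℕ → ℕ → ℕ → ℤ
crossingSgn o α₁ α₂ γ₁ γ₂ = sgn o α₁ γ₁ - sgn o α₁ γ₂ - sgn o α₂ γ₁ + sgn o α₂ γ₂

Disjoint : ℕ → ℕ → ℕ → ℕ → Set
Disjoint α₁ α₂ γ₁ γ₂ = α₁ ≢ γ₁ × α₁ ≢ γ₂ × α₂ ≢ γ₁ × α₂ ≢ γ₂

crossingSgn≡2*crossing : ∀ o {α₁ α₂ γ₁ γ₂} → Disjoint α₁ α₂ γ₁ γ₂ →
                         crossingSgn o α₁ α₂ γ₁ γ₂ ≡ 2ℤ * crossing o α₁ α₂ γ₁ γ₂
crossingSgn≡2*crossing o {α₁} {α₂} {γ₁} {γ₂} (d₁₁ , d₁₂ , d₂₁ , d₂₂) = begin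
  sgn o α₁ γ₁ - sgn o α₁ γ₂ - sgn o α₂ γ₁ + sgn o α₂ γ₂
    ≡⟨ cong₂ (λ u v → u - v - sgn o α₂ γ₁ + sgn o α₂ γ₂) (sgn≡2χ-1 o d₁₁) (sgn≡2χ-1 o d₁₂) ⟩
  (2χ-1 α₁ γ₁) - (2χ-1 α₁ γ₂) - sgn o α₂ γ₁ + sgn o α₂ γ₂
    ≡⟨ cong₂ (λ u v → (2χ-1 α₁ γ₁) - (2χ-1 α₁ γ₂) - u + v) (sgn≡2χ-1 o d₂₁) (sgn≡2χ-1 o d₂₂) ⟩
  (2χ-1 α₁ γ₁) - (2χ-1 α₁ γ₂) - (2χ-1 α₂ γ₁) + (2χ-1 α₂ γ₂)
    ≡⟨ solve 4 (λ a b c d → (con 2ℤ :* a :- con 1ℤ) :- (con 2ℤ :* b :- con 1ℤ) :- (con 2ℤ :* c :- con 1ℤ)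
                            :+ (con 2ℤ :* d :- con 1ℤ) := con 2ℤ :* (a :- b :- c :+ d)) refl
               (χ o α₁ γ₁) (χ o α₁ γ₂) (χ o α₂ γ₁) (χ o α₂ γ₂) ⟩
  2ℤ * crossing o α₁ α₂ γ₁ γ₂ ∎
  where
  open ≡-Reasoning
  2χ-1 : ℕ → ℕ → ℤ
  2χ-1 x y = 2ℤ * χ o x y - 1ℤ

crossing-swap-α : ∀ o α₁ α₂ γ₁ γ₂ → crossing o α₂ α₁ γ₁ γ₂ ≡ - crossing o α₁ α₂ γ₁ γ₂
crossing-swap-α o α₁ α₂ γ₁ γ₂ = solve 4 (λ a b c d → c :- d :- a :+ b := :- (a :- b :- c :+ d)) refl
  (χ o α₁ γ₁) (χ o α₁ γ₂) (χ o α₂ γ₁) (χ o α₂ γ₂)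

crossing-swap-γ : ∀ o α₁ α₂ γ₁ γ₂ → crossing o α₁ α₂ γ₂ γ₁ ≡ - crossing o α₁ α₂ γ₁ γ₂
crossing-swap-γ o α₁ α₂ γ₁ γ₂ = solve 4 (λ a b c d → b :- a :- d :+ c := :- (a :- b :- c :+ d)) refl
  (χ o α₁ γ₁) (χ o α₁ γ₂) (χ o α₂ γ₁) (χ o α₂ γ₂)

crossing-swap-chords : ∀ o {α₁ α₂ γ₁ γ₂} → Disjoint α₁ α₂ γ₁ γ₂ →
                       crossing o γ₁ γ₂ α₁ α₂ ≡ - crossing o α₁ α₂ γ₁ γ₂
crossing-swap-chords o {α₁} {α₂} {γ₁} {γ₂} (d₁₁ , d₁₂ , d₂₁ , d₂₂) = begin
  χ o γ₁ α₁ - χ o γ₁ α₂ - χ o γ₂ α₁ + χ o γ₂ α₂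
    ≡⟨ cong₂ (λ u v → u - v - χ o γ₂ α₁ + χ o γ₂ α₂) (χ-flip o d₁₁) (χ-flip o d₂₁) ⟩
  (1ℤ - χ o α₁ γ₁) - (1ℤ - χ o α₂ γ₁) - χ o γ₂ α₁ + χ o γ₂ α₂
    ≡⟨ cong₂ (λ u v → (1ℤ - χ o α₁ γ₁) - (1ℤ - χ o α₂ γ₁) - u + v) (χ-flip o d₁₂) (χ-flip o d₂₂) ⟩
  (1ℤ - χ o α₁ γ₁) - (1ℤ - χ o α₂ γ₁) - (1ℤ - χ o α₁ γ₂) + (1ℤ - χ o α₂ γ₂)
    ≡⟨ solve 4 (λ a b c d → (con 1ℤ :- a) :- (con 1ℤ :- c) :- (con 1ℤ :- b) :+ (con 1ℤ :- d)
                            := :- (a :- b :- c :+ d)) refl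
               (χ o α₁ γ₁) (χ o α₁ γ₂) (χ o α₂ γ₁) (χ o α₂ γ₂) ⟩
  - crossing o α₁ α₂ γ₁ γ₂ ∎
  where open ≡-Reasoning

side-∈01 : ∀ o {α₁ α₂} p → lt o α₁ α₂ ≡ true →
           χ o α₁ p - χ o α₂ p ≡ 0ℤ ⊎ χ o α₁ p - χ o α₂ p ≡ 1ℤ
side-∈01 o {α₁} {α₂} p α₁<α₂ with lt o α₁ p in α₁<p | lt o α₂ p in α₂<p
... | true  | true  = inj₁ refl
... | true  | false = inj₂ refl
... | false | false = inj₁ refl
... | false | true  with () ← trans (sym α₁<p) (lt-trans o α₁ α₂ p α₁<α₂ α₂<p)

difference-∈01 : ∀ {a b} → a ≡ 0ℤ ⊎ a ≡ 1ℤ → b ≡ 0ℤ ⊎ b ≡ 1ℤ → IsZeroOrUnit (a - b)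
difference-∈01 (inj₁ refl) (inj₁ refl) = inj₁ refl
difference-∈01 (inj₁ refl) (inj₂ refl) = inj₂ (inj₂ refl)
difference-∈01 (inj₂ refl) (inj₁ refl) = inj₂ (inj₁ refl)
difference-∈01 (inj₂ refl) (inj₂ refl) = inj₁ refl

-- The crossing number is the difference of the indicators of γ₁ and γ₂ lying between α₁ and α₂.
crossing-IsZeroOrUnit : ∀ o α₁ α₂ γ₁ γ₂ → IsZeroOrUnit (crossing o α₁ α₂ γ₁ γ₂)
crossing-IsZeroOrUnit o α₁ α₂ γ₁ γ₂ = by-cases
  where
  sides : ∀ a b → (χ o a γ₁ - χ o b γ₁) - (χ o a γ₂ - χ o b γ₂) ≡ crossing o a b γ₁ γ₂
  sides a b = solve 4 (λ p q r s → (p :- r) :- (q :- s) := p :- q :- r :+ s) refl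
                (χ o a γ₁) (χ o a γ₂) (χ o b γ₁) (χ o b γ₂)
  by-cases : IsZeroOrUnit (crossing o α₁ α₂ γ₁ γ₂)
  by-cases with α₁ ℕ.≟ α₂
  ... | yes refl = inj₁ (solve 2 (λ a b → a :- b :- a :+ b := con 0ℤ) refl (χ o α₁ γ₁) (χ o α₁ γ₂))
  ... | no α₁≢α₂ with lt o α₁ α₂ in α₁<α₂
  ...   | true  = subst IsZeroOrUnit (sides α₁ α₂)
                    (difference-∈01 (side-∈01 o γ₁ α₁<α₂) (side-∈01 o γ₂ α₁<α₂))
  ...   | false = subst IsZeroOrUnit (trans (cong -_ (sides α₂ α₁)) (sym (crossing-swap-α o α₂ α₁ γ₁ γ₂)))
                    (IsZeroOrUnit-neg (difference-∈01 (side-∈01 o γ₁ α₂<α₁) (side-∈01 o γ₂ α₂<α₁)))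
    where α₂<α₁ = lt-connex o α₁ α₂ α₁≢α₂ α₁<α₂

record ChordDiagram (k : ℕ) : Set where
  field
    order          : LinearOrder
    end₁ end₂      : Fin k → ℕ
    end₁-injective : ∀ {i j} → end₁ i ≡ end₁ j → i ≡ j
    end₂-injective : ∀ {i j} → end₂ i ≡ end₂ j → i ≡ j
    end₁≢end₂      : ∀ i j → end₁ i ≢ end₂ j

  chordCrossing : Fin k → Fin k → ℤ
  chordCrossing r l = crossing order (end₁ r) (end₂ r) (end₁ l) (end₂ l)

  chordCrossingSgn : Fin k → Fin k → ℤ
  chordCrossingSgn r l = crossingSgn order (end₁ r) (end₂ r) (end₁ l) (end₂ l)

  disjoint : ∀ {r l} → r ≢ l → Disjoint (end₁ r) (end₂ r) (end₁ l) (end₂ l)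
  disjoint r≢l =
    r≢l ∘ end₁-injective , end₁≢end₂ _ _ , (λ e → end₁≢end₂ _ _ (sym e)) , r≢l ∘ end₂-injective

open ChordDiagram public

interlace : ∀ {k} → ChordDiagram k → Matrix k
interlace D r l = if does (r ≟ l) then 0ℤ else chordCrossing D r l

module _ {k} (D : ChordDiagram k) where

  interlace-diag : ∀ r → interlace D r r ≡ 0ℤ
  interlace-diag r rewrite dec-true (r ≟ r) refl = refl

  interlace-off : ∀ {r l} → r ≢ l → interlace D r l ≡ chordCrossing D r l
  interlace-off {r} {l} r≢l rewrite dec-false (r ≟ l) r≢l = refl

  2*interlace : ∀ r l → 2ℤ * interlace D r l ≡ chordCrossingSgn D r l
  2*interlace r l with r ≟ l
  ... | yes refl = solve 4 (λ p u v w → con 0ℤ := (p :- p) :- (u :- v) :- (v :- u) :+ (w :- w)) refl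
                     (χ o e₁ e₁) (χ o e₁ e₂) (χ o e₂ e₁) (χ o e₂ e₂)
    where o = order D
          e₁ = end₁ D r
          e₂ = end₂ D r
  ... | no r≢l = sym (crossingSgn≡2*crossing (order D) (disjoint D r≢l))

  interlace-skew : ∀ r l → interlace D l r ≡ - interlace D r l
  interlace-skew r l = ℤ.*-cancelˡ-≡ 2ℤ (interlace D l r) (- interlace D r l) (begin
    2ℤ * interlace D l r      ≡⟨ 2*interlace l r ⟩
    chordCrossingSgn D l r       ≡⟨ solve 8 (λ p p′ q q′ u u′ v v′ →
                                              (p′ :- p) :- (u′ :- u) :- (q′ :- q) :+ (v′ :- v)
                                              := :- ((p :- p′) :- (q :- q′) :- (u :- u′) :+ (v :- v′))) refl
                                            (χ o a₁ a₂) (χ o a₂ a₁) (χ o a₁ b₂) (χ o b₂ a₁)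
                                            (χ o b₁ a₂) (χ o a₂ b₁) (χ o b₁ b₂) (χ o b₂ b₁) ⟩
    - chordCrossingSgn D r l     ≡⟨ cong -_ (sym (2*interlace r l)) ⟩
    - (2ℤ * interlace D r l)  ≡⟨ ℤ.neg-distribʳ-* 2ℤ (interlace D r l) ⟩
    2ℤ * - interlace D r l    ∎)
    where
    open ≡-Reasoning
    o = order D
    a₁ = end₁ D r
    b₁ = end₂ D r
    a₂ = end₁ D l
    b₂ = end₂ D l

  interlace-IsZeroOrUnit : ∀ r l → IsZeroOrUnit (interlace D r l)
  interlace-IsZeroOrUnit r l with r ≟ l
  ... | yes _ = inj₁ refl
  ... | no  _ = crossing-IsZeroOrUnit (order D) _ _ _ _

restrict : ∀ {k m} → ChordDiagram k → (f : Fin m → Fin k) → (∀ {i j} → f i ≡ f j → i ≡ j) → ChordDiagram m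
restrict D f f-injective = record
  { order          = order D
  ; end₁           = end₁ D ∘ f
  ; end₂           = end₂ D ∘ f
  ; end₁-injective = f-injective ∘ end₁-injective D
  ; end₂-injective = f-injective ∘ end₂-injective D
  ; end₁≢end₂      = λ i j → end₁≢end₂ D (f i) (f j)
  }

interlace-restrict : ∀ {k m} (D : ChordDiagram k) (f : Fin m → Fin k) (f-injective : ∀ {i j} → f i ≡ f j → i ≡ j) →
                     ∀ i j → interlace (restrict D f f-injective) i j ≡ interlace D (f i) (f j)
interlace-restrict D f f-injective i j with i ≟ j
... | yes refl = sym (interlace-diag D (f i))
... | no  i≢j  = sym (interlace-off D (i≢j ∘ f-injective))

-- The pivot of a chord diagram on two crossing chords

bool→ℕ : Bool → ℕ
bool→ℕ true  = 1
bool→ℕ false = 0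

countBelow₂ : LinearOrder → ℕ → ℕ → ℕ → ℕ
countBelow₂ o a b y = bool→ℕ (lt o a y) ℕ.+ bool→ℕ (lt o b y)

countBelow : LinearOrder → ℕ → ℕ → ℕ → ℕ → ℕ → ℕ
countBelow o α₁ α₂ γ₁ γ₂ y = countBelow₂ o α₁ α₂ y ℕ.+ countBelow₂ o γ₁ γ₂ y

-- Segment n of the line consists of the points above exactly n of the four ends c₀ < c₁ < c₂ < c₃ of the pivot
-- chords {c₀, c₂} and {c₁, c₃}; the pivot exchanges the segments 1 and 3.
swapSegments : ℕ → ℕ
swapSegments 1 = 3
swapSegments 3 = 1
swapSegments n = n

swapSegments-involutive : ∀ n → swapSegments (swapSegments n) ≡ n
swapSegments-involutive 0 = refl
swapSegments-involutive 1 = refl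
swapSegments-involutive 2 = refl
swapSegments-involutive 3 = refl
swapSegments-involutive (suc (suc (suc (suc n)))) = refl

swapSegments-injective : ∀ {m n} → swapSegments m ≡ swapSegments n → m ≡ n
swapSegments-injective {m} {n} e =
  trans (sym (swapSegments-involutive m)) (trans (cong swapSegments e) (swapSegments-involutive n))

-- sgn cᵢ y for y in segment n
segmentSgn : ℕ → ℕ → ℤ
segmentSgn n i = 2ℤ * bool→ℤ (i ℕ.<ᵇ n) - 1ℤ

pivotCorrection : ℕ → ℕ → ℤ
pivotCorrection n m = (segmentSgn n 1 - segmentSgn n 3) * (segmentSgn m 0 - segmentSgn m 2)
                    - (segmentSgn n 0 - segmentSgn n 2) * (segmentSgn m 1 - segmentSgn m 3)

SegmentIdentity : ℕ → ℕ → Set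
SegmentIdentity n m = 2ℤ * sgn ℕ-order (swapSegments n) (swapSegments m)
                    ≡ 2ℤ * sgn ℕ-order n m + pivotCorrection n m

segment-identity : ∀ {n m} → n ℕ.< 5 → m ℕ.< 5 → SegmentIdentity n m
segment-identity n<5 m<5 = subst₂ SegmentIdentity (Fin.toℕ-fromℕ< n<5) (Fin.toℕ-fromℕ< m<5)
  (all-segments (Fin.fromℕ< n<5) (Fin.fromℕ< m<5))
  where
  all-segments : ∀ (n m : Fin 5) → SegmentIdentity (toℕ n) (toℕ m)
  all-segments = toWitness {a? = Fin.all? λ n → Fin.all? λ m → _ ℤ.≟ _} _

-- The sum is ordered as in countBelow o c₀ c₂ c₁ c₃.
antitone-count : ∀ b₀ b₁ b₂ b₃ →
  (b₁ ≡ true → b₀ ≡ true) → (b₂ ≡ true → b₁ ≡ true) → (b₃ ≡ true → b₂ ≡ true) →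
  let n = (bool→ℕ b₀ ℕ.+ bool→ℕ b₂) ℕ.+ (bool→ℕ b₁ ℕ.+ bool→ℕ b₃) in
  (b₀ ≡ (0 ℕ.<ᵇ n)) × (b₁ ≡ (1 ℕ.<ᵇ n)) × (b₂ ≡ (2 ℕ.<ᵇ n)) × (b₃ ≡ (3 ℕ.<ᵇ n)) × n ℕ.< 5
antitone-count false true  _     _    h _ _ with () ← h refl
antitone-count _     false true  _    _ h _ with () ← h refl
antitone-count _     _     false true _ _ h with () ← h refl
antitone-count false false false false _ _ _ = refl , refl , refl , refl , ℕ.s≤s ℕ.z≤n
antitone-count true  false false false _ _ _ = refl , refl , refl , refl , ℕ.s≤s (ℕ.s≤s ℕ.z≤n)
antitone-count true  true  false false _ _ _ = refl , refl , refl , refl , ℕ.s≤s (ℕ.s≤s (ℕ.s≤s ℕ.z≤n))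
antitone-count true  true  true  false _ _ _ = refl , refl , refl , refl , ℕ.s≤s (ℕ.s≤s (ℕ.s≤s (ℕ.s≤s ℕ.z≤n)))
antitone-count true  true  true  true  _ _ _ = refl , refl , refl , refl , ℕ.≤-refl

Avoids : ℕ → ℕ → ℕ → ℕ → ℕ → Set
Avoids x α₁ α₂ γ₁ γ₂ = α₁ ≢ x × α₂ ≢ x × γ₁ ≢ x × γ₂ ≢ x

sgnDiffˡ : LinearOrder → ℕ → ℕ → ℕ → ℤ
sgnDiffˡ o c d x = sgn o x c - sgn o x d

sgnDiffʳ : LinearOrder → ℕ → ℕ → ℕ → ℤ
sgnDiffʳ o c d y = sgn o c y - sgn o d y

-- Summed over the ends of two chords this becomes the Schur complement formula interlace-pivot.
PivotIdentity : LinearOrder → LinearOrder → ℕ → ℕ → ℕ → ℕ → Set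
PivotIdentity o o′ α₁ α₂ γ₁ γ₂ = ∀ x y → Avoids x α₁ α₂ γ₁ γ₂ → Avoids y α₁ α₂ γ₁ γ₂ →
  2ℤ * sgn o′ x y ≡ 2ℤ * sgn o x y - X * (sgnDiffˡ o γ₁ γ₂ x * sgnDiffʳ o α₁ α₂ y)
                                         + X * (sgnDiffˡ o α₁ α₂ x * sgnDiffʳ o γ₁ γ₂ y)
  where X = crossing o α₁ α₂ γ₁ γ₂

module SortedPivot (o : LinearOrder) {c₀ c₁ c₂ c₃ : ℕ}
  (c₀<c₁ : lt o c₀ c₁ ≡ true) (c₁<c₂ : lt o c₁ c₂ ≡ true) (c₂<c₃ : lt o c₂ c₃ ≡ true)
  (ν : ℕ → ℕ) (ν-count : ∀ y → ν y ≡ countBelow o c₀ c₂ c₁ c₃ y) where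

  c : Fin 4 → ℕ
  c zero                   = c₀
  c (suc zero)             = c₁
  c (suc (suc zero))       = c₂
  c (suc (suc (suc zero))) = c₃

  segment : ∀ y → (∀ i → lt o (c i) y ≡ (toℕ i ℕ.<ᵇ ν y)) × ν y ℕ.< 5
  segment y = subst (λ n → (∀ i → lt o (c i) y ≡ (toℕ i ℕ.<ᵇ n)) × n ℕ.< 5) (sym (ν-count y)) (by-index , n<5)
    where
    counted = antitone-count (lt o c₀ y) (lt o c₁ y) (lt o c₂ y) (lt o c₃ y)
                (lt-trans o c₀ c₁ y c₀<c₁) (lt-trans o c₁ c₂ y c₁<c₂) (lt-trans o c₂ c₃ y c₂<c₃)
    n<5 = proj₂ (proj₂ (proj₂ (proj₂ counted)))
    by-index : ∀ i → lt o (c i) y ≡ (toℕ i ℕ.<ᵇ countBelow o c₀ c₂ c₁ c₃ y)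
    by-index zero                   = proj₁ counted
    by-index (suc zero)             = proj₁ (proj₂ counted)
    by-index (suc (suc zero))       = proj₁ (proj₂ (proj₂ counted))
    by-index (suc (suc (suc zero))) = proj₁ (proj₂ (proj₂ (proj₂ counted)))

  refines : ∀ {x y} → ν x ℕ.< ν y → lt o x y ≡ true
  refines {x} {y} νx<νy = via-cᵢ (c i ℕ.≟ x)
    where
    νx<4 = ℕ.<-≤-trans νx<νy (ℕ.s≤s⁻¹ (proj₂ (segment y)))
    i = Fin.fromℕ< νx<4
    toℕ-i = Fin.toℕ-fromℕ< νx<4
    cᵢ<y : lt o (c i) y ≡ true
    cᵢ<y = trans (proj₁ (segment y) i) (trans (cong (ℕ._<ᵇ ν y) toℕ-i) (dec-true (ν x ℕ.<? ν y) νx<νy))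
    cᵢ≮x : lt o (c i) x ≡ false
    cᵢ≮x = trans (proj₁ (segment x) i)
                 (trans (cong (ℕ._<ᵇ ν x) toℕ-i) (dec-false (ν x ℕ.<? ν x) (ℕ.<-irrefl refl)))
    via-cᵢ : Dec (c i ≡ x) → lt o x y ≡ true
    via-cᵢ (yes cᵢ≡x)  = subst (λ z → lt o z y ≡ true) cᵢ≡x cᵢ<y
    via-cᵢ (no  cᵢ≢x) = lt-trans o x (c i) y (lt-connex o (c i) x cᵢ≢x cᵢ≮x) cᵢ<y

  sgn-segment : ∀ {y} i → c i ≢ y → sgn o (c i) y ≡ segmentSgn (ν y) (toℕ i)
  sgn-segment {y} i cᵢ≢y = trans (sgn≡2χ-1 o cᵢ≢y) (cong (λ b → 2ℤ * bool→ℤ b - 1ℤ) (proj₁ (segment y) i))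

  pivotOrder : LinearOrder
  pivotOrder = lexOrder o (swapSegments ∘ ν)

  pivot-sgn : ∀ x y → 2ℤ * sgn pivotOrder x y ≡ 2ℤ * sgn o x y + pivotCorrection (ν x) (ν y)
  pivot-sgn x y with ν x ℕ.≟ ν y
  ... | yes νx≡νy = begin
    2ℤ * sgn pivotOrder x y                     ≡⟨ cong (2ℤ *_) (sgn-lex-≡ o (swapSegments ∘ ν) (cong swapSegments νx≡νy)) ⟩
    2ℤ * sgn o x y                              ≡⟨ sym (ℤ.+-identityʳ _) ⟩
    2ℤ * sgn o x y + 0ℤ                         ≡⟨ cong (2ℤ * sgn o x y +_) (sym (diagonal (ν x))) ⟩
    2ℤ * sgn o x y + pivotCorrection (ν x) (ν x) ≡⟨ cong (λ m → 2ℤ * sgn o x y + pivotCorrection (ν x) m) νx≡νy ⟩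
    2ℤ * sgn o x y + pivotCorrection (ν x) (ν y) ∎
    where
    open ≡-Reasoning
    diagonal : ∀ n → pivotCorrection n n ≡ 0ℤ
    diagonal n = solve 4 (λ a b c d → (a :- b) :* (c :- d) :- (c :- d) :* (a :- b) := con 0ℤ) refl
                   (segmentSgn n 1) (segmentSgn n 3) (segmentSgn n 0) (segmentSgn n 2)
  ... | no νx≢νy = begin
    2ℤ * sgn pivotOrder x y
      ≡⟨ cong (2ℤ *_) (sgn-refining pivotOrder (swapSegments ∘ ν) (lexLt-< o (swapSegments ∘ ν))
                                       (νx≢νy ∘ swapSegments-injective)) ⟩
    2ℤ * sgn ℕ-order (swapSegments (ν x)) (swapSegments (ν y))
      ≡⟨ segment-identity (proj₂ (segment x)) (proj₂ (segment y)) ⟩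
    2ℤ * sgn ℕ-order (ν x) (ν y) + pivotCorrection (ν x) (ν y)
      ≡⟨ cong (λ s → 2ℤ * s + pivotCorrection (ν x) (ν y)) (sym (sgn-refining o ν refines νx≢νy)) ⟩
    2ℤ * sgn o x y + pivotCorrection (ν x) (ν y) ∎
    where open ≡-Reasoning

  sorted-pivot-identity : PivotIdentity o pivotOrder c₀ c₂ c₁ c₃
  sorted-pivot-identity x y (c₀≢x , c₂≢x , c₁≢x , c₃≢x) (c₀≢y , c₂≢y , c₁≢y , c₃≢y) =
    trans (pivot-sgn x y)
          (regroup {sgn o x y} {ν x} {ν y} X≡1
                   (sgn-x zero c₀≢x) (sgn-x (suc zero) c₁≢x) (sgn-x (suc (suc zero)) c₂≢x) (sgn-x (suc (suc (suc zero))) c₃≢x)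
                   (sgn-segment zero c₀≢y) (sgn-segment (suc zero) c₁≢y) (sgn-segment (suc (suc zero)) c₂≢y)
                   (sgn-segment (suc (suc (suc zero))) c₃≢y))
    where
    X≡1 : crossing o c₀ c₂ c₁ c₃ ≡ 1ℤ
    X≡1 rewrite c₀<c₁ | lt-trans o c₀ c₂ c₃ (lt-trans o c₀ c₁ c₂ c₀<c₁ c₁<c₂) c₂<c₃ | lt-asym o c₁ c₂ c₁<c₂ | c₂<c₃ = refl
    sgn-x : ∀ i → c i ≢ x → sgn o x (c i) ≡ - segmentSgn (ν x) (toℕ i)
    sgn-x i cᵢ≢x = trans (sgn-antisym o (c i) x) (cong -_ (sgn-segment i cᵢ≢x))
    regroup : ∀ {s n m X a₀ a₁ a₂ a₃ b₀ b₁ b₂ b₃} → X ≡ 1ℤ →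
      a₀ ≡ - segmentSgn n 0 → a₁ ≡ - segmentSgn n 1 → a₂ ≡ - segmentSgn n 2 → a₃ ≡ - segmentSgn n 3 →
      b₀ ≡ segmentSgn m 0 → b₁ ≡ segmentSgn m 1 → b₂ ≡ segmentSgn m 2 → b₃ ≡ segmentSgn m 3 →
      2ℤ * s + pivotCorrection n m ≡ 2ℤ * s - X * ((a₁ - a₃) * (b₀ - b₂)) + X * ((a₀ - a₂) * (b₁ - b₃))
    regroup {s} {n} {m} refl refl refl refl refl refl refl refl refl =
      solve 9 (λ s e₀ e₁ e₂ e₃ f₀ f₁ f₂ f₃ →
                 con 2ℤ :* s :+ ((e₁ :- e₃) :* (f₀ :- f₂) :- (e₀ :- e₂) :* (f₁ :- f₃))
              := con 2ℤ :* s :- con 1ℤ :* (((:- e₁) :- (:- e₃)) :* (f₀ :- f₂))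
                                  :+ con 1ℤ :* (((:- e₀) :- (:- e₂)) :* (f₁ :- f₃))) refl
        s (segmentSgn n 0) (segmentSgn n 1) (segmentSgn n 2) (segmentSgn n 3)
          (segmentSgn m 0) (segmentSgn m 1) (segmentSgn m 2) (segmentSgn m 3)

module _ (o o′ : LinearOrder) where

  pivot-identity-swap-α : ∀ {α₁ α₂ γ₁ γ₂} → PivotIdentity o o′ α₂ α₁ γ₁ γ₂ → PivotIdentity o o′ α₁ α₂ γ₁ γ₂
  pivot-identity-swap-α {α₁} {α₂} {γ₁} {γ₂} I x y (a₁ , a₂ , c₁ , c₂) (b₁ , b₂ , d₁ , d₂) = trans
    (I x y (a₂ , a₁ , c₁ , c₂) (b₂ , b₁ , d₁ , d₂))
    (regroup (crossing-swap-α o α₁ α₂ γ₁ γ₂) (sgn o x α₁) (sgn o x α₂) (sgn o α₁ y) (sgn o α₂ y))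
    where
    regroup : ∀ {X′ X} → X′ ≡ - X → ∀ a₁ a₂ b₁ b₂ →
      2ℤ * sgn o x y - X′ * (sgnDiffˡ o γ₁ γ₂ x * (b₂ - b₁)) + X′ * ((a₂ - a₁) * sgnDiffʳ o γ₁ γ₂ y) ≡
      2ℤ * sgn o x y - X * (sgnDiffˡ o γ₁ γ₂ x * (b₁ - b₂)) + X * ((a₁ - a₂) * sgnDiffʳ o γ₁ γ₂ y)
    regroup {X = X} refl a₁ a₂ b₁ b₂ = solve 8 (λ w X g h a₁ a₂ b₁ b₂ →
        w :- (:- X) :* (g :* (b₂ :- b₁)) :+ (:- X) :* ((a₂ :- a₁) :* h)
      := w :- X :* (g :* (b₁ :- b₂)) :+ X :* ((a₁ :- a₂) :* h)) refl
      (2ℤ * sgn o x y) X (sgnDiffˡ o γ₁ γ₂ x) (sgnDiffʳ o γ₁ γ₂ y) a₁ a₂ b₁ b₂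

  pivot-identity-swap-γ : ∀ {α₁ α₂ γ₁ γ₂} → PivotIdentity o o′ α₁ α₂ γ₂ γ₁ → PivotIdentity o o′ α₁ α₂ γ₁ γ₂
  pivot-identity-swap-γ {α₁} {α₂} {γ₁} {γ₂} I x y (a₁ , a₂ , c₁ , c₂) (b₁ , b₂ , d₁ , d₂) = trans
    (I x y (a₁ , a₂ , c₂ , c₁) (b₁ , b₂ , d₂ , d₁))
    (regroup (crossing-swap-γ o α₁ α₂ γ₁ γ₂) (sgn o x γ₁) (sgn o x γ₂) (sgn o γ₁ y) (sgn o γ₂ y))
    where
    regroup : ∀ {X′ X} → X′ ≡ - X → ∀ c₁ c₂ d₁ d₂ →
      2ℤ * sgn o x y - X′ * ((c₂ - c₁) * sgnDiffʳ o α₁ α₂ y) + X′ * (sgnDiffˡ o α₁ α₂ x * (d₂ - d₁)) ≡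
      2ℤ * sgn o x y - X * ((c₁ - c₂) * sgnDiffʳ o α₁ α₂ y) + X * (sgnDiffˡ o α₁ α₂ x * (d₁ - d₂))
    regroup {X = X} refl c₁ c₂ d₁ d₂ = solve 8 (λ w X g h c₁ c₂ d₁ d₂ →
        w :- (:- X) :* ((c₂ :- c₁) :* h) :+ (:- X) :* (g :* (d₂ :- d₁))
      := w :- X :* ((c₁ :- c₂) :* h) :+ X :* (g :* (d₁ :- d₂))) refl
      (2ℤ * sgn o x y) X (sgnDiffˡ o α₁ α₂ x) (sgnDiffʳ o α₁ α₂ y) c₁ c₂ d₁ d₂

  pivot-identity-swap-chords : ∀ {α₁ α₂ γ₁ γ₂} → Disjoint α₁ α₂ γ₁ γ₂ →
    PivotIdentity o o′ γ₁ γ₂ α₁ α₂ → PivotIdentity o o′ α₁ α₂ γ₁ γ₂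
  pivot-identity-swap-chords {α₁} {α₂} {γ₁} {γ₂} disjoint I x y (a₁ , a₂ , c₁ , c₂) (b₁ , b₂ , d₁ , d₂) = trans
    (I x y (c₁ , c₂ , a₁ , a₂) (d₁ , d₂ , b₁ , b₂))
    (regroup (crossing-swap-chords o disjoint))
    where
    regroup : ∀ {X′ X} → X′ ≡ - X →
      2ℤ * sgn o x y - X′ * (sgnDiffˡ o α₁ α₂ x * sgnDiffʳ o γ₁ γ₂ y) + X′ * (sgnDiffˡ o γ₁ γ₂ x * sgnDiffʳ o α₁ α₂ y) ≡
      2ℤ * sgn o x y - X * (sgnDiffˡ o γ₁ γ₂ x * sgnDiffʳ o α₁ α₂ y) + X * (sgnDiffˡ o α₁ α₂ x * sgnDiffʳ o γ₁ γ₂ y)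
    regroup {X = X} refl = solve 4 (λ w X p q → w :- (:- X) :* q :+ (:- X) :* p := w :- X :* p :+ X :* q) refl
      (2ℤ * sgn o x y) X (sgnDiffˡ o γ₁ γ₂ x * sgnDiffʳ o α₁ α₂ y) (sgnDiffˡ o α₁ α₂ x * sgnDiffʳ o γ₁ γ₂ y)

Distinct4 : ℕ → ℕ → ℕ → ℕ → Set
Distinct4 α₁ α₂ γ₁ γ₂ = α₁ ≢ α₂ × Disjoint α₁ α₂ γ₁ γ₂ × γ₁ ≢ γ₂

by-lt : ∀ {A : Set} o x y → (lt o x y ≡ true → A) → (lt o x y ≡ false → A) → A
by-lt o x y if-lt if-not with lt o x y
... | true  = if-lt refl
... | false = if-not refl

≢0-neg : ∀ {X′ X} → X′ ≡ - X → X ≢ 0ℤ → X′ ≢ 0ℤ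
≢0-neg X′≡-X X≢0 X′≡0 = X≢0 (ℤ.neg-injective (trans (sym X′≡-X) X′≡0))

module _ (o : LinearOrder) (ν : ℕ → ℕ) where

  Pivotable : ℕ → ℕ → ℕ → ℕ → Set
  Pivotable α₁ α₂ γ₁ γ₂ =
    Distinct4 α₁ α₂ γ₁ γ₂ × crossing o α₁ α₂ γ₁ γ₂ ≢ 0ℤ × (∀ y → ν y ≡ countBelow o α₁ α₂ γ₁ γ₂ y)

  private
    o′ : LinearOrder
    o′ = lexOrder o (swapSegments ∘ ν)

    swap-α : ∀ {α₁ α₂ γ₁ γ₂} → Pivotable α₁ α₂ γ₁ γ₂ → Pivotable α₂ α₁ γ₁ γ₂
    swap-α {α₁} {α₂} {γ₁} {γ₂} ((α₁≢α₂ , (α₁≢γ₁ , α₁≢γ₂ , α₂≢γ₁ , α₂≢γ₂) , γ₁≢γ₂) , X≢0 , counts) =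
      (α₁≢α₂ ∘ sym , (α₂≢γ₁ , α₂≢γ₂ , α₁≢γ₁ , α₁≢γ₂) , γ₁≢γ₂) ,
      ≢0-neg (crossing-swap-α o α₁ α₂ γ₁ γ₂) X≢0 ,
      λ y → trans (counts y) (cong (ℕ._+ countBelow₂ o γ₁ γ₂ y) (ℕ.+-comm (bool→ℕ (lt o α₁ y)) (bool→ℕ (lt o α₂ y))))

    swap-γ : ∀ {α₁ α₂ γ₁ γ₂} → Pivotable α₁ α₂ γ₁ γ₂ → Pivotable α₁ α₂ γ₂ γ₁
    swap-γ {α₁} {α₂} {γ₁} {γ₂} ((α₁≢α₂ , (α₁≢γ₁ , α₁≢γ₂ , α₂≢γ₁ , α₂≢γ₂) , γ₁≢γ₂) , X≢0 , counts) =
      (α₁≢α₂ , (α₁≢γ₂ , α₁≢γ₁ , α₂≢γ₂ , α₂≢γ₁) , γ₁≢γ₂ ∘ sym) ,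
      ≢0-neg (crossing-swap-γ o α₁ α₂ γ₁ γ₂) X≢0 ,
      λ y → trans (counts y) (cong (countBelow₂ o α₁ α₂ y ℕ.+_) (ℕ.+-comm (bool→ℕ (lt o γ₁ y)) (bool→ℕ (lt o γ₂ y))))

    swap-chords : ∀ {α₁ α₂ γ₁ γ₂} → Pivotable α₁ α₂ γ₁ γ₂ → Pivotable γ₁ γ₂ α₁ α₂
    swap-chords {α₁} {α₂} {γ₁} {γ₂} ((α₁≢α₂ , disjoint@(α₁≢γ₁ , α₁≢γ₂ , α₂≢γ₁ , α₂≢γ₂) , γ₁≢γ₂) , X≢0 , counts) =
      (γ₁≢γ₂ , (α₁≢γ₁ ∘ sym , α₂≢γ₁ ∘ sym , α₁≢γ₂ ∘ sym , α₂≢γ₂ ∘ sym) , α₁≢α₂) ,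
      ≢0-neg (crossing-swap-chords o disjoint) X≢0 ,
      λ y → trans (counts y) (ℕ.+-comm (countBelow₂ o α₁ α₂ y) (countBelow₂ o γ₁ γ₂ y))

  pivot-identity-ordered : ∀ {α₁ α₂ γ₁ γ₂} → lt o α₁ α₂ ≡ true → lt o γ₁ γ₂ ≡ true → lt o α₁ γ₁ ≡ true →
                           Pivotable α₁ α₂ γ₁ γ₂ → PivotIdentity o o′ α₁ α₂ γ₁ γ₂
  pivot-identity-ordered {α₁} {α₂} {γ₁} {γ₂} α₁<α₂ γ₁<γ₂ α₁<γ₁ ((_ , (_ , _ , α₂≢γ₁ , _) , _) , X≢0 , counts) =
    by-lt o γ₁ α₂
      (λ γ₁<α₂ → by-lt o α₂ γ₂
        (λ α₂<γ₂ → SortedPivot.sorted-pivot-identity o α₁<γ₁ γ₁<α₂ α₂<γ₂ ν counts)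
        (λ α₂≮γ₂ → ⊥-elim (X≢0 (crossing-≡0 α₁<γ₁ α₁<γ₂ (lt-asym o γ₁ α₂ γ₁<α₂) α₂≮γ₂))))
      (λ γ₁≮α₂ → let α₂<γ₁ = lt-connex o γ₁ α₂ (α₂≢γ₁ ∘ sym) γ₁≮α₂ in
        ⊥-elim (X≢0 (crossing-≡0 α₁<γ₁ α₁<γ₂ α₂<γ₁ (lt-trans o α₂ γ₁ γ₂ α₂<γ₁ γ₁<γ₂))))
    where
    α₁<γ₂ = lt-trans o α₁ γ₁ γ₂ α₁<γ₁ γ₁<γ₂
    crossing-≡0 : ∀ {b₁ b₂} → lt o α₁ γ₁ ≡ b₁ → lt o α₁ γ₂ ≡ b₁ → lt o α₂ γ₁ ≡ b₂ → lt o α₂ γ₂ ≡ b₂ →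
                  crossing o α₁ α₂ γ₁ γ₂ ≡ 0ℤ
    crossing-≡0 {b₁} {b₂} refl e₁ refl e₂ rewrite e₁ | e₂ =
      solve 2 (λ a b → a :- a :- b :+ b := con 0ℤ) refl (bool→ℤ b₁) (bool→ℤ b₂)

  pivot-identity-ordered-ends : ∀ {α₁ α₂ γ₁ γ₂} → lt o α₁ α₂ ≡ true → lt o γ₁ γ₂ ≡ true →
                                Pivotable α₁ α₂ γ₁ γ₂ → PivotIdentity o o′ α₁ α₂ γ₁ γ₂
  pivot-identity-ordered-ends {α₁} {α₂} {γ₁} {γ₂} α₁<α₂ γ₁<γ₂ p@((_ , disjoint@(α₁≢γ₁ , _) , _) , _) =
    by-lt o α₁ γ₁
      (λ α₁<γ₁ → pivot-identity-ordered α₁<α₂ γ₁<γ₂ α₁<γ₁ p)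
      (λ α₁≮γ₁ → pivot-identity-swap-chords o o′ disjoint
        (pivot-identity-ordered γ₁<γ₂ α₁<α₂ (lt-connex o α₁ γ₁ α₁≢γ₁ α₁≮γ₁) (swap-chords p)))

  pivot-identity-ordered-α : ∀ {α₁ α₂ γ₁ γ₂} → lt o α₁ α₂ ≡ true →
                             Pivotable α₁ α₂ γ₁ γ₂ → PivotIdentity o o′ α₁ α₂ γ₁ γ₂
  pivot-identity-ordered-α {α₁} {α₂} {γ₁} {γ₂} α₁<α₂ p@((_ , _ , γ₁≢γ₂) , _) =
    by-lt o γ₁ γ₂
      (λ γ₁<γ₂ → pivot-identity-ordered-ends α₁<α₂ γ₁<γ₂ p)
      (λ γ₁≮γ₂ → pivot-identity-swap-γ o o′
        (pivot-identity-ordered-ends α₁<α₂ (lt-connex o γ₁ γ₂ γ₁≢γ₂ γ₁≮γ₂) (swap-γ p)))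

  pivot-identity : ∀ {α₁ α₂ γ₁ γ₂} → Pivotable α₁ α₂ γ₁ γ₂ → PivotIdentity o o′ α₁ α₂ γ₁ γ₂
  pivot-identity {α₁} {α₂} p@((α₁≢α₂ , _) , _) =
    by-lt o α₁ α₂
      (λ α₁<α₂ → pivot-identity-ordered-α α₁<α₂ p)
      (λ α₁≮α₂ → pivot-identity-swap-α o o′
        (pivot-identity-ordered-α (lt-connex o α₁ α₂ α₁≢α₂ α₁≮α₂) (swap-α p)))

sgnDiffˡ-crossingSgn : ∀ o c d x₁ x₂ → sgnDiffˡ o c d x₁ - sgnDiffˡ o c d x₂ ≡ crossingSgn o x₁ x₂ c d
sgnDiffˡ-crossingSgn o c d x₁ x₂ = solve 4 (λ a b e f → (a :- b) :- (e :- f) := a :- b :- e :+ f) refl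
  (sgn o x₁ c) (sgn o x₁ d) (sgn o x₂ c) (sgn o x₂ d)

sgnDiffʳ-crossingSgn : ∀ o c d y₁ y₂ → sgnDiffʳ o c d y₁ - sgnDiffʳ o c d y₂ ≡ crossingSgn o c d y₁ y₂
sgnDiffʳ-crossingSgn o c d y₁ y₂ = solve 4 (λ a b e f → (a :- b) :- (e :- f) := a :- e :- b :+ f) refl
  (sgn o c y₁) (sgn o d y₁) (sgn o c y₂) (sgn o d y₂)

pivot-crossingSgn : ∀ {o o′ α₁ α₂ γ₁ γ₂} → PivotIdentity o o′ α₁ α₂ γ₁ γ₂ → ∀ {x₁ x₂ y₁ y₂} →
  Avoids x₁ α₁ α₂ γ₁ γ₂ → Avoids x₂ α₁ α₂ γ₁ γ₂ → Avoids y₁ α₁ α₂ γ₁ γ₂ → Avoids y₂ α₁ α₂ γ₁ γ₂ →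
  let X = crossing o α₁ α₂ γ₁ γ₂ in
  2ℤ * crossingSgn o′ x₁ x₂ y₁ y₂ ≡
    2ℤ * crossingSgn o x₁ x₂ y₁ y₂ - X * (crossingSgn o x₁ x₂ γ₁ γ₂ * crossingSgn o α₁ α₂ y₁ y₂)
                                      + X * (crossingSgn o x₁ x₂ α₁ α₂ * crossingSgn o γ₁ γ₂ y₁ y₂)
pivot-crossingSgn {o} {o′} {α₁} {α₂} {γ₁} {γ₂} I {x₁} {x₂} {y₁} {y₂} ax₁ ax₂ ay₁ ay₂ = begin
  2ℤ * (sgn o′ x₁ y₁ - sgn o′ x₁ y₂ - sgn o′ x₂ y₁ + sgn o′ x₂ y₂)
    ≡⟨ solve 4 (λ a b c d → con 2ℤ :* (a :- b :- c :+ d) := con 2ℤ :* a :- con 2ℤ :* b :- con 2ℤ :* c :+ con 2ℤ :* d) refl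
         (sgn o′ x₁ y₁) (sgn o′ x₁ y₂) (sgn o′ x₂ y₁) (sgn o′ x₂ y₂) ⟩
  2ℤ * sgn o′ x₁ y₁ - 2ℤ * sgn o′ x₁ y₂ - 2ℤ * sgn o′ x₂ y₁ + 2ℤ * sgn o′ x₂ y₂
    ≡⟨ cong₂ (λ a b → a - b - 2ℤ * sgn o′ x₂ y₁ + 2ℤ * sgn o′ x₂ y₂) (I x₁ y₁ ax₁ ay₁) (I x₁ y₂ ax₁ ay₂) ⟩
  t x₁ y₁ - t x₁ y₂ - 2ℤ * sgn o′ x₂ y₁ + 2ℤ * sgn o′ x₂ y₂
    ≡⟨ cong₂ (λ a b → t x₁ y₁ - t x₁ y₂ - a + b) (I x₂ y₁ ax₂ ay₁) (I x₂ y₂ ax₂ ay₂) ⟩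
  t x₁ y₁ - t x₁ y₂ - t x₂ y₁ + t x₂ y₂
    ≡⟨ solve 13 (λ X s₁₁ s₁₂ s₂₁ s₂₂ g₁ g₂ g₁′ g₂′ h₁ h₂ h₁′ h₂′ →
           (con 2ℤ :* s₁₁ :- X :* (g₁ :* h₁) :+ X :* (g₁′ :* h₁′)) :- (con 2ℤ :* s₁₂ :- X :* (g₁ :* h₂) :+ X :* (g₁′ :* h₂′))
         :- (con 2ℤ :* s₂₁ :- X :* (g₂ :* h₁) :+ X :* (g₂′ :* h₁′)) :+ (con 2ℤ :* s₂₂ :- X :* (g₂ :* h₂) :+ X :* (g₂′ :* h₂′))
         := con 2ℤ :* (s₁₁ :- s₁₂ :- s₂₁ :+ s₂₂) :- X :* ((g₁ :- g₂) :* (h₁ :- h₂)) :+ X :* ((g₁′ :- g₂′) :* (h₁′ :- h₂′))) refl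
         X (sgn o x₁ y₁) (sgn o x₁ y₂) (sgn o x₂ y₁) (sgn o x₂ y₂)
         (sgnDiffˡ o γ₁ γ₂ x₁) (sgnDiffˡ o γ₁ γ₂ x₂) (sgnDiffˡ o α₁ α₂ x₁) (sgnDiffˡ o α₁ α₂ x₂)
         (sgnDiffʳ o α₁ α₂ y₁) (sgnDiffʳ o α₁ α₂ y₂) (sgnDiffʳ o γ₁ γ₂ y₁) (sgnDiffʳ o γ₁ γ₂ y₂) ⟩
  2ℤ * crossingSgn o x₁ x₂ y₁ y₂
    - X * ((sgnDiffˡ o γ₁ γ₂ x₁ - sgnDiffˡ o γ₁ γ₂ x₂) * (sgnDiffʳ o α₁ α₂ y₁ - sgnDiffʳ o α₁ α₂ y₂))
    + X * ((sgnDiffˡ o α₁ α₂ x₁ - sgnDiffˡ o α₁ α₂ x₂) * (sgnDiffʳ o γ₁ γ₂ y₁ - sgnDiffʳ o γ₁ γ₂ y₂))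
    ≡⟨ cong₂ (λ a b → 2ℤ * crossingSgn o x₁ x₂ y₁ y₂ - X * a + X * b)
         (cong₂ _*_ (sgnDiffˡ-crossingSgn o γ₁ γ₂ x₁ x₂) (sgnDiffʳ-crossingSgn o α₁ α₂ y₁ y₂))
         (cong₂ _*_ (sgnDiffˡ-crossingSgn o α₁ α₂ x₁ x₂) (sgnDiffʳ-crossingSgn o γ₁ γ₂ y₁ y₂)) ⟩
  2ℤ * crossingSgn o x₁ x₂ y₁ y₂ - X * (crossingSgn o x₁ x₂ γ₁ γ₂ * crossingSgn o α₁ α₂ y₁ y₂)
                                 + X * (crossingSgn o x₁ x₂ α₁ α₂ * crossingSgn o γ₁ γ₂ y₁ y₂) ∎
  where
  open ≡-Reasoning
  X = crossing o α₁ α₂ γ₁ γ₂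
  t : ℕ → ℕ → ℤ
  t x y = 2ℤ * sgn o x y - X * (sgnDiffˡ o γ₁ γ₂ x * sgnDiffʳ o α₁ α₂ y) + X * (sgnDiffˡ o α₁ α₂ x * sgnDiffʳ o γ₁ γ₂ y)

otherChord : ∀ {k} → Fin (suc k) → Fin k → Fin (suc (suc k))
otherChord q′ u = suc (punchIn q′ u)

otherChord-injective : ∀ {k} (q′ : Fin (suc k)) {u v} → otherChord q′ u ≡ otherChord q′ v → u ≡ v
otherChord-injective q′ e = Fin.punchIn-injective q′ _ _ (Fin.suc-injective e)

pivot : ∀ {k} → ChordDiagram (suc (suc k)) → Fin (suc k) → ChordDiagram k
pivot D q′ = record (restrict D (otherChord q′) (otherChord-injective q′))
  { order = lexOrder (order D)
              (swapSegments ∘ countBelow (order D) (end₁ D zero) (end₂ D zero) (end₁ D (suc q′)) (end₂ D (suc q′))) }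

module _ {k} (D : ChordDiagram (suc (suc k))) (q′ : Fin (suc k)) (x≢0 : interlace D zero (suc q′) ≢ 0ℤ) where

  private
    q = suc q′
    M = interlace D
    x = M zero q
    o = order D
    α₁ = end₁ D zero
    α₂ = end₂ D zero
    γ₁ = end₁ D q
    γ₂ = end₂ D q
    0≢q : zero ≢ q
    0≢q ()
    X≡x : crossing o α₁ α₂ γ₁ γ₂ ≡ x
    X≡x = sym (interlace-off D 0≢q)
    avoids : ∀ r → r ≢ zero → r ≢ q → Avoids (end₁ D r) α₁ α₂ γ₁ γ₂ × Avoids (end₂ D r) α₁ α₂ γ₁ γ₂
    avoids r r≢0 r≢q =
      (r≢0 ∘ sym ∘ end₁-injective D , (λ e → end₁≢end₂ D r zero (sym e)) ,
       r≢q ∘ sym ∘ end₁-injective D , (λ e → end₁≢end₂ D r q (sym e))) ,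
      (end₁≢end₂ D zero r , r≢0 ∘ sym ∘ end₂-injective D , end₁≢end₂ D q r , r≢q ∘ sym ∘ end₂-injective D)
    avoids-other : ∀ u → Avoids (end₁ D (otherChord q′ u)) α₁ α₂ γ₁ γ₂ × Avoids (end₂ D (otherChord q′ u)) α₁ α₂ γ₁ γ₂
    avoids-other u = avoids (otherChord q′ u) (λ ()) (Fin.punchInᵢ≢i q′ u ∘ Fin.suc-injective)
    identity : PivotIdentity o (order (pivot D q′)) α₁ α₂ γ₁ γ₂
    identity = pivot-identity o (countBelow o α₁ α₂ γ₁ γ₂)
      ((end₁≢end₂ D zero zero , disjoint D 0≢q , end₁≢end₂ D q q) , (λ X≡0 → x≢0 (trans (sym X≡x) X≡0)) , λ _ → refl)

  interlace-pivot : ∀ u v → let r = otherChord q′ u ; l = otherChord q′ v in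
    interlace (pivot D q′) u v ≡ M r l - x * (M r q * M zero l) + x * (M r zero * M q l)
  interlace-pivot u v = ℤ.*-cancelˡ-≡ 2ℤ _ _ (ℤ.*-cancelˡ-≡ 2ℤ _ _ (begin
    2ℤ * (2ℤ * interlace (pivot D q′) u v)
      ≡⟨ cong (2ℤ *_) (2*interlace (pivot D q′) u v) ⟩
    2ℤ * crossingSgn (order (pivot D q′)) (end₁ D r) (end₂ D r) (end₁ D l) (end₂ D l)
      ≡⟨ pivot-crossingSgn {o} {order (pivot D q′)} identity (proj₁ (avoids-other u)) (proj₂ (avoids-other u))
                                    (proj₁ (avoids-other v)) (proj₂ (avoids-other v)) ⟩
    2ℤ * chordCrossingSgn D r l - X * (chordCrossingSgn D r q * chordCrossingSgn D zero l)
                                + X * (chordCrossingSgn D r zero * chordCrossingSgn D q l)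
      ≡⟨ cong₂ (λ a b → 2ℤ * a - X * b + X * (chordCrossingSgn D r zero * chordCrossingSgn D q l))
           (sym (2*interlace D r l)) (sym (cong₂ _*_ (2*interlace D r q) (2*interlace D zero l))) ⟩
    2ℤ * (2ℤ * M r l) - X * ((2ℤ * M r q) * (2ℤ * M zero l)) + X * (chordCrossingSgn D r zero * chordCrossingSgn D q l)
      ≡⟨ cong₂ (λ X′ b → 2ℤ * (2ℤ * M r l) - X′ * ((2ℤ * M r q) * (2ℤ * M zero l)) + X′ * b)
           X≡x (sym (cong₂ _*_ (2*interlace D r zero) (2*interlace D q l))) ⟩
    2ℤ * (2ℤ * M r l) - x * ((2ℤ * M r q) * (2ℤ * M zero l)) + x * ((2ℤ * M r zero) * (2ℤ * M q l))
      ≡⟨ solve 6 (λ m x a b c d → con 2ℤ :* (con 2ℤ :* m) :- x :* ((con 2ℤ :* a) :* (con 2ℤ :* b))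
                                                         :+ x :* ((con 2ℤ :* c) :* (con 2ℤ :* d))
                  := con 2ℤ :* (con 2ℤ :* (m :- x :* (a :* b) :+ x :* (c :* d)))) refl
           (M r l) x (M r q) (M zero l) (M r zero) (M q l) ⟩
    2ℤ * (2ℤ * (M r l - x * (M r q * M zero l) + x * (M r zero * M q l))) ∎))
    where
    open ≡-Reasoning
    r = otherChord q′ u
    l = otherChord q′ v
    X = crossing o α₁ α₂ γ₁ γ₂

  det-pivot : det (interlace D) ≡ det (interlace (pivot D q′))
  det-pivot = begin
    det M
      ≡⟨ sym (det-add-multiples-of-column M q λ₁ λ₁q) ⟩
    det N₁
      ≡⟨ det-expand-row N₁ zero q N₁-row₀ ⟩
    -1ℤ ^ toℕ q * (N₁ zero q * det N₂)
      ≡⟨ cong (λ y → -1ℤ ^ toℕ q * (y * det N₂)) N₁₀q ⟩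
    -1ℤ ^ toℕ q * (x * det N₂)
      ≡⟨ cong (λ d → -1ℤ ^ toℕ q * (x * d)) (sym (det-add-multiples-of-column N₂ zero μ refl)) ⟩
    -1ℤ ^ toℕ q * (x * det N₃)
      ≡⟨ cong (λ d → -1ℤ ^ toℕ q * (x * d)) (det-expand-row N₃ q′ zero N₃-row-q′) ⟩
    -1ℤ ^ toℕ q * (x * (-1ℤ ^ (toℕ q′ ℕ.+ 0) * (N₃ q′ zero * det (minor N₃ q′ zero))))
      ≡⟨ cong₂ (λ e y → -1ℤ ^ toℕ q * (x * (-1ℤ ^ e * (y * det (minor N₃ q′ zero))))) (ℕ.+-identityʳ (toℕ q′)) N₃q′₀ ⟩
    -1ℤ ^ toℕ q * (x * (-1ℤ ^ toℕ q′ * (- x * det (minor N₃ q′ zero))))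
      ≡⟨ solve 3 (λ s x d → (con -1ℤ :* s) :* (x :* (s :* ((:- x) :* d))) := (s :* s) :* ((x :* x) :* d)) refl
           (-1ℤ ^ toℕ q′) x (det (minor N₃ q′ zero)) ⟩
    (-1ℤ ^ toℕ q′ * -1ℤ ^ toℕ q′) * ((x * x) * det (minor N₃ q′ zero))
      ≡⟨ cong₂ (λ a b → a * (b * det (minor N₃ q′ zero))) (-1^n*-1^n≡1 (toℕ q′)) x*x≡1 ⟩
    1ℤ * (1ℤ * det (minor N₃ q′ zero))
      ≡⟨ trans (ℤ.*-identityˡ _) (ℤ.*-identityˡ _) ⟩
    det (minor N₃ q′ zero)
      ≡⟨ det-cong N₄≗pivot ⟩
    det (interlace (pivot D q′)) ∎
    where
    open ≡-Reasoning
    x*x≡1 : x * x ≡ 1ℤ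
    x*x≡1 = IsZeroOrUnit-square (interlace-IsZeroOrUnit D zero q) x≢0
    cancel : ∀ a → a + (- x * a) * x ≡ 0ℤ
    cancel a = begin
      a + (- x * a) * x  ≡⟨ solve 2 (λ a x → a :+ ((:- x) :* a) :* x := a :- (x :* x) :* a) refl a x ⟩
      a - (x * x) * a    ≡⟨ cong (λ y → a - y * a) x*x≡1 ⟩
      a - 1ℤ * a         ≡⟨ cong (λ y → a - y) (ℤ.*-identityˡ a) ⟩
      a - a              ≡⟨ ℤ.+-inverseʳ a ⟩
      0ℤ                 ∎
    λ₁ : Fin (suc (suc k)) → ℤ
    λ₁ l = if does (l ≟ q) then 0ℤ else - x * M zero l
    λ₁q : λ₁ q ≡ 0ℤ
    λ₁q rewrite dec-true (q ≟ q) refl = refl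
    λ₁-off : ∀ {l} → l ≢ q → λ₁ l ≡ - x * M zero l
    λ₁-off {l} l≢q rewrite dec-false (l ≟ q) l≢q = refl
    N₁ : Matrix (suc (suc k))
    N₁ r l = M r l + λ₁ l * M r q
    N₁-row₀ : ∀ l → l ≢ q → N₁ zero l ≡ 0ℤ
    N₁-row₀ l l≢q = trans (cong (λ c → M zero l + c * x) (λ₁-off l≢q)) (cancel (M zero l))
    N₁₀q : N₁ zero q ≡ x
    N₁₀q = trans (cong (λ c → x + c * x) λ₁q) (ℤ.+-identityʳ x)
    N₂ : Matrix (suc k)
    N₂ = minor N₁ zero q
    N₂q′₀ : N₂ q′ zero ≡ - x
    N₂q′₀ = begin
      M q zero + λ₁ zero * M q q  ≡⟨ cong (λ y → M q zero + λ₁ zero * y) (interlace-diag D q) ⟩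
      M q zero + λ₁ zero * 0ℤ     ≡⟨ cong (M q zero +_) (ℤ.*-zeroʳ (λ₁ zero)) ⟩
      M q zero + 0ℤ               ≡⟨ ℤ.+-identityʳ (M q zero) ⟩
      M q zero                    ≡⟨ interlace-skew D zero q ⟩
      - x                         ∎
    μ : Fin (suc k) → ℤ
    μ c = if does (c ≟ zero) then 0ℤ else x * N₂ q′ c
    N₃ : Matrix (suc k)
    N₃ r c = N₂ r c + μ c * N₂ r zero
    N₃-row-q′ : ∀ c → c ≢ zero → N₃ q′ c ≡ 0ℤ
    N₃-row-q′ zero    c≢0 = ⊥-elim (c≢0 refl)
    N₃-row-q′ (suc c) _   = begin
      N₂ q′ (suc c) + (x * N₂ q′ (suc c)) * N₂ q′ zero
        ≡⟨ cong (λ y → N₂ q′ (suc c) + (x * N₂ q′ (suc c)) * y) N₂q′₀ ⟩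
      N₂ q′ (suc c) + (x * N₂ q′ (suc c)) * - x
        ≡⟨ solve 2 (λ a x → a :+ (x :* a) :* (:- x) := a :+ ((:- x) :* a) :* x) refl (N₂ q′ (suc c)) x ⟩
      N₂ q′ (suc c) + (- x * N₂ q′ (suc c)) * x
        ≡⟨ cancel (N₂ q′ (suc c)) ⟩
      0ℤ ∎
    N₃q′₀ : N₃ q′ zero ≡ - x
    N₃q′₀ = trans (ℤ.+-identityʳ (N₂ q′ zero)) N₂q′₀
    N₄≗pivot : ∀ u v → minor N₃ q′ zero u v ≡ interlace (pivot D q′) u v
    N₄≗pivot u v = begin
      (M r l + λ₁ l * M r q) + (x * (M q l + λ₁ l * M q q)) * (M r zero + λ₁ zero * M r q)
        ≡⟨ cong₂ (λ c d → (M r l + c * M r q) + (x * (M q l + c * d)) * (M r zero + λ₁ zero * M r q))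
                 (λ₁-off (Fin.punchInᵢ≢i q′ v ∘ Fin.suc-injective)) (interlace-diag D q) ⟩
      (M r l + (- x * M zero l) * M r q) + (x * (M q l + (- x * M zero l) * 0ℤ)) * (M r zero + λ₁ zero * M r q)
        ≡⟨ cong (λ d → (M r l + (- x * M zero l) * M r q)
                       + (x * (M q l + (- x * M zero l) * 0ℤ)) * (M r zero + (- x * d) * M r q))
                (interlace-diag D zero) ⟩
      (M r l + (- x * M zero l) * M r q) + (x * (M q l + (- x * M zero l) * 0ℤ)) * (M r zero + (- x * 0ℤ) * M r q)
        ≡⟨ solve 6 (λ m x a b c d → (m :+ ((:- x) :* a) :* b)
                                    :+ (x :* (c :+ ((:- x) :* a) :* con 0ℤ)) :* (d :+ ((:- x) :* con 0ℤ) :* b)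
                    := m :- x :* (b :* a) :+ x :* (d :* c)) refl
             (M r l) x (M zero l) (M r q) (M q l) (M r zero) ⟩
      M r l - x * (M r q * M zero l) + x * (M r zero * M q l)
        ≡⟨ sym (interlace-pivot u v) ⟩
      interlace (pivot D q′) u v ∎
      where
      r = otherChord q′ u
      l = otherChord q′ v

-- Determinants of interlace matrices

data Odd : ℕ → Set where
  one   : Odd 1
  2+odd : ∀ {k} → Odd k → Odd (suc (suc k))

odd-or-odd-suc : ∀ k → Odd k ⊎ Odd (suc k)
odd-or-odd-suc zero    = inj₂ one
odd-or-odd-suc (suc k) with odd-or-odd-suc k
... | inj₁ odd = inj₂ (2+odd odd)
... | inj₂ odd = inj₁ odd

det-interlace : ∀ {k} (D : ChordDiagram k) → IsZeroOrUnit (det (interlace D)) × (Odd k → det (interlace D) ≡ 0ℤ)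
det-interlace {zero} D = inj₂ (inj₁ refl) , λ ()
det-interlace {suc zero} D = inj₁ det≡0 , λ _ → det≡0
  where
  det≡0 : det (interlace D) ≡ 0ℤ
  det≡0 = det-zero-row (interlace D) zero λ { zero → interlace-diag D zero }
det-interlace {suc (suc k)} D with Fin.any? (λ q → ¬? (interlace D zero q ℤ.≟ 0ℤ))
... | yes (zero , M₀₀≢0)    = ⊥-elim (M₀₀≢0 (interlace-diag D zero))
... | yes (suc q′ , M₀q≢0) =
  subst IsZeroOrUnit (sym det≡) (proj₁ (det-interlace (pivot D q′))) ,
  λ { (2+odd odd) → trans det≡ (proj₂ (det-interlace (pivot D q′)) odd) }
  where det≡ = det-pivot D q′ M₀q≢0
... | no row₀≢0 = inj₁ det≡0 , λ _ → det≡0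
  where
  det≡0 : det (interlace D) ≡ 0ℤ
  det≡0 = det-zero-row (interlace D) zero λ q →
    decidable-stable (interlace D zero q ℤ.≟ 0ℤ) (λ M₀q≢0 → row₀≢0 (q , M₀q≢0))

-1^[n+n]≡1 : ∀ n → -1ℤ ^ (n ℕ.+ n) ≡ 1ℤ
-1^[n+n]≡1 n = trans (ℤ.^-distribˡ-+-* -1ℤ n n) (-1^n*-1^n≡1 n)

row-≡-interlace : ∀ {k} (D : ChordDiagram k) (P : Matrix k) → (∀ r c → r ≢ c → P r c ≡ interlace D r c) →
                  ∀ r → P r r ≡ 0ℤ → ∀ c → P r c ≡ interlace D r c
row-≡-interlace D P P-off r Prr≡0 c = by-cases (r ≟ c)
  where
  by-cases : Dec (r ≡ c) → P r c ≡ interlace D r c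
  by-cases (yes refl) = trans Prr≡0 (sym (interlace-diag D r))
  by-cases (no  r≢c)  = P-off r c r≢c

det-framed-interlace : ∀ {k} (D : ChordDiagram (suc k)) (i : Fin (suc k)) (P : Matrix (suc k)) →
  (∀ r c → r ≢ c → P r c ≡ interlace D r c) → P i i ≡ 1ℤ → (∀ r → r ≢ i → P r r ≡ 0ℤ) →
  det P ≡ det (interlace D) + det (interlace (restrict D (punchIn i) (Fin.punchIn-injective i _ _)))
det-framed-interlace D i P P-off Pii P-diag = begin
  det P                                       ≡⟨ det-linear-row i 1ℤ P (interlace D) T P≗M-off-i P≗T-off-i P-row-i ⟩
  det (interlace D) + 1ℤ * det T              ≡⟨ cong (det (interlace D) +_) (ℤ.*-identityˡ (det T)) ⟩
  det (interlace D) + det T                   ≡⟨ cong (det (interlace D) +_) det-T ⟩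
  det (interlace D) + det (interlace D′)      ∎
  where
  open ≡-Reasoning
  D′ = restrict D (punchIn i) (Fin.punchIn-injective i _ _)
  unit : Fin _ → ℤ
  unit c = if does (c ≟ i) then 1ℤ else 0ℤ
  T : Matrix _
  T r c = if does (r ≟ i) then unit c else interlace D r c
  T-row-i : ∀ c → T i c ≡ unit c
  T-row-i c rewrite dec-true (i ≟ i) refl = refl
  T-off-i : ∀ r c → r ≢ i → T r c ≡ interlace D r c
  T-off-i r c r≢i rewrite dec-false (r ≟ i) r≢i = refl
  unit-i : T i i ≡ 1ℤ
  unit-i = trans (T-row-i i) (cong (if_then 1ℤ else 0ℤ) (dec-true (i ≟ i) refl))
  unit-off : ∀ c → c ≢ i → unit c ≡ 0ℤ
  unit-off c c≢i rewrite dec-false (c ≟ i) c≢i = refl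
  P≗M-off-i : ∀ r c → r ≢ i → P r c ≡ interlace D r c
  P≗M-off-i r c r≢i = row-≡-interlace D P P-off r (P-diag r r≢i) c
  P≗T-off-i : ∀ r c → r ≢ i → P r c ≡ T r c
  P≗T-off-i r c r≢i = trans (P≗M-off-i r c r≢i) (sym (T-off-i r c r≢i))
  P-row-i : ∀ c → P i c ≡ interlace D i c + 1ℤ * T i c
  P-row-i c = by-cases (c ≟ i)
    where
    by-cases : Dec (c ≡ i) → P i c ≡ interlace D i c + 1ℤ * T i c
    by-cases (yes refl) = begin
      P i i                               ≡⟨ Pii ⟩
      0ℤ + 1ℤ * 1ℤ                        ≡⟨ cong₂ (λ a b → a + 1ℤ * b) (sym (interlace-diag D i)) (sym unit-i) ⟩
      interlace D i i + 1ℤ * T i i        ∎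
    by-cases (no  c≢i) = begin
      P i c                               ≡⟨ P-off i c (c≢i ∘ sym) ⟩
      interlace D i c                     ≡⟨ sym (ℤ.+-identityʳ _) ⟩
      interlace D i c + 1ℤ * 0ℤ           ≡⟨ cong (λ b → interlace D i c + 1ℤ * b) (sym (trans (T-row-i c) (unit-off c c≢i))) ⟩
      interlace D i c + 1ℤ * T i c        ∎
  det-T : det T ≡ det (interlace D′)
  det-T = begin
    det T                                          ≡⟨ det-expand-row T i i (λ c c≢i → trans (T-row-i c) (unit-off c c≢i)) ⟩
    -1ℤ ^ (toℕ i ℕ.+ toℕ i) * (T i i * det (minor T i i))
      ≡⟨ cong₂ (λ s t → s * (t * det (minor T i i))) (-1^[n+n]≡1 (toℕ i)) unit-i ⟩
    1ℤ * (1ℤ * det (minor T i i))                  ≡⟨ trans (ℤ.*-identityˡ _) (ℤ.*-identityˡ _) ⟩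
    det (minor T i i)
      ≡⟨ det-cong (λ u v → trans (T-off-i _ _ (Fin.punchInᵢ≢i i u))
                                 (sym (interlace-restrict D (punchIn i) (Fin.punchIn-injective i _ _) u v))) ⟩
    det (interlace D′)                             ∎

framed-det-IsZeroOrUnit : ∀ {k} (D : ChordDiagram k) (P : Matrix k) → (∀ r c → r ≢ c → P r c ≡ interlace D r c) →
  (∀ r → P r r ≡ 0ℤ) ⊎ (∃ λ i → P i i ≡ 1ℤ × (∀ r → r ≢ i → P r r ≡ 0ℤ)) → IsZeroOrUnit (det P)
framed-det-IsZeroOrUnit D P P-off (inj₁ P-diag) =
  subst IsZeroOrUnit (sym (det-cong P≗M)) (proj₁ (det-interlace D))
  where
  P≗M : ∀ r c → P r c ≡ interlace D r c
  P≗M r = row-≡-interlace D P P-off r (P-diag r)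
framed-det-IsZeroOrUnit {suc k} D P P-off (inj₂ (i , Pii , P-diag)) with odd-or-odd-suc k
... | inj₁ odd-k = subst IsZeroOrUnit (sym (trans det-P (trans (cong (det (interlace D) +_) (proj₂ (det-interlace D′) odd-k))
                                                               (ℤ.+-identityʳ _))))
                     (proj₁ (det-interlace D))
  where
  D′ = restrict D (punchIn i) (Fin.punchIn-injective i _ _)
  det-P = det-framed-interlace D i P P-off Pii P-diag
... | inj₂ odd-1+k = subst IsZeroOrUnit (sym (trans det-P (trans (cong (_+ det (interlace D′)) (proj₂ (det-interlace D) odd-1+k))
                                                                 (ℤ.+-identityˡ _))))
                       (proj₁ (det-interlace D′))
  where
  D′ = restrict D (punchIn i) (Fin.punchIn-injective i _ _)
  det-P = det-framed-interlace D i P P-off Pii P-diag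

-- The intersection matrix of a bouquet

-- does (cyc3? x y z) computes to majority (x <ᵇ y) (y <ᵇ z) (z <ᵇ x) on the positions of x, y, z.
majority : Bool → Bool → Bool → Bool
majority a b c = (a ∧ b) ∨ ((b ∧ c) ∨ (c ∧ a))

majority-reverse-not : ∀ a b c → majority (not c) (not b) (not a) ≡ not (majority a b c)
majority-reverse-not true  true  true  = refl
majority-reverse-not true  true  false = refl
majority-reverse-not true  false true  = refl
majority-reverse-not true  false false = refl
majority-reverse-not false true  true  = refl
majority-reverse-not false true  false = refl
majority-reverse-not false false true  = refl
majority-reverse-not false false false = refl

cyclic-reverse : ∀ o {x y z} → x ≢ y → y ≢ z → z ≢ x →
  majority (lt o x y) (lt o y z) (lt o z x) ≡ not (majority (lt o x z) (lt o z y) (lt o y x))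
cyclic-reverse o {x} {y} {z} x≢y y≢z z≢x
  rewrite lt-flip o y x (x≢y ∘ sym) | lt-flip o z y (y≢z ∘ sym) | lt-flip o x z (z≢x ∘ sym) =
  majority-reverse-not (lt o x z) (lt o z y) (lt o y x)

cyclic-χ : ∀ o {x p y} → x ≢ p → p ≢ y → y ≢ x →
  bool→ℤ (majority (lt o x p) (lt o p y) (lt o y x)) ≡ χ o x p - χ o y p + χ o y x
cyclic-χ o {x} {p} {y} x≢p p≢y y≢x rewrite χ-flip o p≢y with lt o x p in x<p | lt o p y in p<y | lt o y x in y<x
... | true  | true  | false = refl
... | true  | false | true  = refl
... | true  | false | false = refl
... | false | true  | true  = refl
... | false | true  | false = refl
... | false | false | true  = refl
... | true  | true  | true  with () ← trans (sym (lt-irrefl o x)) (lt-trans o x y x (lt-trans o x p y x<p p<y) y<x)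
... | false | false | false with () ← trans (sym (lt-irrefl o x))
        (lt-trans o x y x (lt-connex o y x (y≢x) y<x)
          (lt-trans o y p x (lt-connex o p y p≢y p<y) (lt-connex o x p x≢p x<p)))

signedChoice : Bool → Bool → ℤ
signedChoice u v = if u ∧ not v then ℤ.+ 1 else if v ∧ not u then - (ℤ.+ 1) else ℤ.+ 0

signedChoice≡ : ∀ u v → signedChoice u v ≡ bool→ℤ u - bool→ℤ v
signedChoice≡ true  true  = refl
signedChoice≡ true  false = refl
signedChoice≡ false true  = refl
signedChoice≡ false false = refl

bouquetDiagram : ∀ {n} → Bouquet n → ChordDiagram n
bouquetDiagram B = record
  { order          = ℕ-order
  ; end₁           = toℕ ∘ a B
  ; end₂           = toℕ ∘ b B
  ; end₁-injective = a-injective B ∘ Fin.toℕ-injective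
  ; end₂-injective = b-injective B ∘ Fin.toℕ-injective
  ; end₁≢end₂      = λ i j → a≢b B i j ∘ Fin.toℕ-injective
  }

upperEntry≡interlace : ∀ {n} (B : Bouquet n) {i j} → i ≢ j → upperEntry B i j ≡ interlace (bouquetDiagram B) i j
upperEntry≡interlace B {i} {j} i≢j = begin
  upperEntry B i j
    ≡⟨ cong₂ (λ v v′ → if arc x ∧ v then ℤ.+ 1 else if arc z ∧ v′ then - (ℤ.+ 1) else ℤ.+ 0)
             (cyclic-reverse ℕ-order w≢y y≢z z≢w) (cyclic-reverse ℕ-order w≢y (y≢x) (w≢x ∘ sym)) ⟩
  signedChoice (arc x) (arc z)
    ≡⟨ signedChoice≡ (arc x) (arc z) ⟩
  bool→ℤ (arc x) - bool→ℤ (arc z)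
    ≡⟨ cong₂ _-_ (cyclic-χ ℕ-order w≢x (y≢x ∘ sym) (w≢y ∘ sym)) (cyclic-χ ℕ-order (z≢w ∘ sym) (y≢z ∘ sym) (w≢y ∘ sym)) ⟩
  (χ ℕ-order w x - χ ℕ-order y x + χ ℕ-order y w) - (χ ℕ-order w z - χ ℕ-order y z + χ ℕ-order y w)
    ≡⟨ solve 5 (λ a b c d e → (a :- b :+ e) :- (c :- d :+ e) := a :- c :- b :+ d) refl
         (χ ℕ-order w x) (χ ℕ-order y x) (χ ℕ-order w z) (χ ℕ-order y z) (χ ℕ-order y w) ⟩
  chordCrossing (bouquetDiagram B) i j
    ≡⟨ sym (interlace-off (bouquetDiagram B) i≢j) ⟩
  interlace (bouquetDiagram B) i j ∎
  where
  open ≡-Reasoning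
  w = toℕ (a B i)
  y = toℕ (b B i)
  x = toℕ (a B j)
  z = toℕ (b B j)
  arc : ℕ → Bool
  arc p = majority (lt ℕ-order w p) (lt ℕ-order p y) (lt ℕ-order y w)
  w≢y : w ≢ y
  w≢y = end₁≢end₂ (bouquetDiagram B) i i
  disjoint-ij = disjoint (bouquetDiagram B) i≢j
  w≢x = proj₁ disjoint-ij
  z≢w : z ≢ w
  z≢w = proj₁ (proj₂ disjoint-ij) ∘ sym
  y≢x = proj₁ (proj₂ (proj₂ disjoint-ij))
  y≢z = proj₂ (proj₂ (proj₂ disjoint-ij))

intersectionMatrix-diag : ∀ {n} (B : Bouquet n) i → intersectionMatrix B i i ≡ bool→ℤ (nonOrientable B i)
intersectionMatrix-diag B i with does (i Fin.<? i) in i<i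
... | true with () ← trans (sym i<i) (dec-false (i Fin.<? i) (ℕ.<-irrefl refl))
... | false = refl

intersectionMatrix≡interlace : ∀ {n} (B : Bouquet n) {i j} → i ≢ j → intersectionMatrix B i j ≡ interlace (bouquetDiagram B) i j
intersectionMatrix≡interlace B {i} {j} i≢j with Fin.<-cmp i j
... | tri< i<j _ _ = trans (upper (dec-true (i Fin.<? j) i<j)) (upperEntry≡interlace B i≢j)
  where
  upper : does (i Fin.<? j) ≡ true → intersectionMatrix B i j ≡ upperEntry B i j
  upper i<ᵇj with does (i Fin.<? j)
  ... | true = refl
... | tri≈ _ i≡j _ = ⊥-elim (i≢j i≡j)
... | tri> i≮j _ j<i = begin
  intersectionMatrix B i j             ≡⟨ lower (dec-false (i Fin.<? j) i≮j) (dec-true (j Fin.<? i) j<i) ⟩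
  - upperEntry B j i                   ≡⟨ cong -_ (upperEntry≡interlace B (i≢j ∘ sym)) ⟩
  - interlace (bouquetDiagram B) j i   ≡⟨ sym (interlace-skew (bouquetDiagram B) j i) ⟩
  interlace (bouquetDiagram B) i j     ∎
  where
  open ≡-Reasoning
  lower : does (i Fin.<? j) ≡ false → does (j Fin.<? i) ≡ true → intersectionMatrix B i j ≡ - upperEntry B j i
  lower i≮ᵇj j<ᵇi with does (i Fin.<? j) | does (j Fin.<? i)
  ... | false | true = refl

strictlyIncreasing-injective : ∀ {k n} {σ : Fin k → Fin n} → StrictlyIncreasing σ → ∀ {i j} → σ i ≡ σ j → i ≡ j
strictlyIncreasing-injective {σ = σ} σ-increasing {i} {j} σi≡σj with Fin.<-cmp i j
... | tri< i<j _ _ = ⊥-elim (ℕ.<-irrefl (cong toℕ σi≡σj) (σ-increasing i j i<j))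
... | tri≈ _ i≡j _ = i≡j
... | tri> _ _ j<i = ⊥-elim (ℕ.<-irrefl (cong toℕ (sym σi≡σj)) (σ-increasing j i j<i))

corollary4p7 : (n : ℕ) (B : Bouquet n) → ExactlyOneNonOrientable B →
    PrincipallyUnimodular (intersectionMatrix B)
corollary4p7 n B (i₀ , i₀-nonOrientable , unique) k σ σ-increasing det≢0 =
  IsZeroOrUnit-≢0 (framed-det-IsZeroOrUnit D P P-off framing) det≢0
  where
  σ-injective = strictlyIncreasing-injective σ-increasing
  D = restrict (bouquetDiagram B) σ σ-injective
  P = principalSubmatrix (intersectionMatrix B) σ
  P-off : ∀ r c → r ≢ c → P r c ≡ interlace D r c
  P-off r c r≢c = trans (intersectionMatrix≡interlace B (r≢c ∘ σ-injective))
                        (sym (interlace-restrict (bouquetDiagram B) σ σ-injective r c))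
  P-diag : ∀ r → P r r ≡ bool→ℤ (nonOrientable B (σ r))
  P-diag r = intersectionMatrix-diag B (σ r)
  orientable : ∀ r → σ r ≢ i₀ → P r r ≡ 0ℤ
  orientable r σr≢i₀ with nonOrientable B (σ r) in non
  ... | true  = ⊥-elim (σr≢i₀ (unique (σ r) non))
  ... | false = trans (P-diag r) (cong bool→ℤ non)
  framing : (∀ r → P r r ≡ 0ℤ) ⊎ (∃ λ i → P i i ≡ 1ℤ × (∀ r → r ≢ i → P r r ≡ 0ℤ))
  framing with Fin.any? (λ i → σ i ≟ i₀)
  ... | yes (i , σi≡i₀) = inj₂ (i , trans (P-diag i) (cong bool→ℤ (trans (cong (nonOrientable B) σi≡i₀) i₀-nonOrientable)) ,
                               λ r r≢i → orientable r (λ σr≡i₀ → r≢i (σ-injective (trans σr≡i₀ (sym σi≡i₀)))))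
  ... | no  σ≢i₀ = inj₁ λ r → orientable r λ σr≡i₀ → σ≢i₀ (r , σr≡i₀)
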